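{- Let $\mathcal{X}=(\Omega,S)$ be the Tatra scheme $\mathcal{X}(q,n)$. For $\sigma\in\mathrm{Aut}(C)$ and $g\in C$, let $\varphi_{\sigma,g}$ be the permutation of $S$ given by $r_h^{\varphi_{\sigma,g}}=r_{h^\sigma}$ and $s_h^{\varphi_{\sigma,g}}=s_{h^\sigma g}$ for all $h\in C$. Then the group $\mathrm{Aut}_{\mathrm{alg}}(\mathcal{X})$ of algebraic automorphisms of $\mathcal{X}$ equals $\{\varphi_{\sigma,g}:\sigma\in\mathrm{Aut}(C),\ g\in C\}$ (a group isomorphic to $\mathrm{Aut}(D_{2n})\cong\mathrm{Hol}(C)$).
   Context: Let $r$ be a prime, $q=r^d$, $\mathbb{F}=\mathbb{F}_q$, $n\mid q-1$ with $q(q-1)/n$ even, $K\le\mathbb{F}^*$ the subgroup of index $n$, $C=\mathbb{F}^*/K$ (cyclic of order $n$). $\Omega=\{Kv:v\in\mathbb{F}^2\setminus\{0\}\}$ with $Kv=\{xv:x\in K\}$; for $g=Ky\in C$, $g(Kv)=K(yv)$. $\langle Ku,Kv\rangle=K\det(u,v)\in C\cup\{0\}$ (value $0$ iff $\det(u,v)=0$). For $g\in C$: $r_g=\{(\alpha,\beta):\langle\alpha,\beta\rangle=0,\ \beta=g\alpha\}$, $s_g=\{(\alpha,\beta):\langle\alpha,\beta\rangle=g\}$; $S=\{r_g,s_g:g\in C\}$, and $(\Omega,S)$ is an association scheme with intersection numbers $c_{rs}^t$ ($r,s,t\in S$). An algebraic automorphism of $\mathcal{X}$ is a permutation $\varphi$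 of $S$ with $c_{rs}^t=c_{r^\varphi s^\varphi}^{t^\varphi}$ for all $r,s,t\in S$; they form the group $\mathrm{Aut}_{\mathrm{alg}}(\mathcal{X})$. -}

module Defs where

open import Level using (0ℓ)
open import Data.Nat as ℕ using (ℕ)
open import Data.Product using (Σ; ∃; _×_; _,_; proj₁; proj₂)
open import Data.Product.Properties using (≡-dec)
open import Data.List using (List; length; filter; cartesianProduct)
open import Data.List.Membership.Propositional using (_∈_)
open import Data.List.Relation.Unary.Unique.Propositional using (Unique)
open import Data.List.Relation.Unary.Any using (Any; any?)
open import Relation.Nullary using (¬_; Dec; yes; no)
open import Relation.Nullary.Decidable using (_×-dec_; ¬?)
open import Relation.Unary using (Pred; Decidable)
open import Relation.Binary using (DecidableEquality)
open import Relation.Binary.PropositionalEquality using (_≡_; _≢_)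
import Algebra.Structures as AS

record FiniteField : Set₁ where
  infixl 7 _*_
  infixl 6 _+_
  field
    F      : Set
    _+_    : F → F → F
    _*_    : F → F → F
    -_     : F → F
    0# 1#  : F
    isCommutativeRing : AS.IsCommutativeRing _≡_ _+_ _*_ -_ 0# 1#
    _⁻¹    : F → F
    inverseʳ : ∀ x → x ≢ 0# → x * (x ⁻¹) ≡ 1#
    0≢1    : 0# ≢ 1#
    _≟_    : DecidableEquality F
    elems  : List F
    elems-complete : ∀ x → x ∈ elems
    elems-unique   : Unique elems

  order : ℕ
  order = length elems

count : {A : Set} {P : Pred A 0ℓ} → Decidable P → List A → ℕ
count P? xs = length (filter P? xs)

module Tatra (𝔽 : FiniteField) where
  open FiniteField 𝔽

  V : Set
  V = F × F

  _≟V_ : DecidableEquality V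
  _≟V_ = ≡-dec _≟_ _≟_

  NonZeroV : V → Set
  NonZeroV (a , b) = ¬ (a ≡ 0# × b ≡ 0#)

  nzV? : Decidable NonZeroV
  nzV? (a , b) = ¬? ((a ≟ 0#) ×-dec (b ≟ 0#))

  _·_ : F → V → V
  x · (a , b) = (x * a , x * b)

  det : V → V → F
  det (a , b) (c , d) = (a * d) + (- (b * c))

  vecs : List V
  vecs = filter nzV? (cartesianProduct elems elems)

  record Subgroup (n : ℕ) : Set₁ where
    field
      K         : F → Set
      K?        : Decidable K
      K-nonzero : ∀ {x} → K x → x ≢ 0#
      K-one     : K 1#
      K-mul     : ∀ {x y} → K x → K y → K (x * y)
      K-index   : count K? elems ℕ.* n ≡ order ℕ.∸ 1

  module WithK {n : ℕ} (H : Subgroup n) where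
    open Subgroup H

    -- C = F*/K : an element Kx of C is represented by a nonzero x ∈ F;
    -- Kx = Ky iff x y⁻¹ ∈ K.
    _~_ : F → F → Set
    x ~ y = K (x * (y ⁻¹))

    _~?_ : ∀ x y → Dec (x ~ y)
    x ~? y = K? (x * (y ⁻¹))

    -- Ω = {Kv : v ∈ F²∖0}: a point Kv is represented by a nonzero vector v;
    -- Ku = Kv iff v = k·u for some k ∈ K.
    _≈Ω_ : V → V → Set
    u ≈Ω v = Any (λ k → K k × v ≡ k · u) elems

    _≈Ω?_ : ∀ u v → Dec (u ≈Ω v)
    u ≈Ω? v = any? (λ k → K? k ×-dec (v ≟V (k · u))) elems

    -- S = {r_g, s_g : g ∈ C}.  A basis relation is represented by a tag
    -- and a nonzero representative of g.
    data Tag : Set where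
      rT sT : Tag

    SRep : Set
    SRep = Tag × F

    ValidS : SRep → Set
    ValidS (_ , x) = x ≢ 0#

    _≈S_ : SRep → SRep → Set
    (t , x) ≈S (t′ , y) = t ≡ t′ × x ~ y

    -- (Ku, Kv) ∈ r_g  iff  ⟨Ku,Kv⟩ = 0 and Kv = g(Ku) = K(xu)   (g = Kx)
    -- (Ku, Kv) ∈ s_g  iff  ⟨Ku,Kv⟩ = K det(u,v) = g             (g = Kx)
    InRel : SRep → V → V → Set
    InRel (rT , x) u v = det u v ≡ 0# × (x · u) ≈Ω v
    InRel (sT , x) u v = det u v ≢ 0# × det u v ~ x

    InRel? : ∀ t u v → Dec (InRel t u v)
    InRel? (rT , x) u v = (det u v ≟ 0#) ×-dec ((x · u) ≈Ω? v)
    InRel? (sT , x) u v = ¬? (det u v ≟ 0#) ×-dec (det u v ~? x)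

    -- Number of nonzero vectors w with (Kα,Kw) ∈ ρ and (Kw,Kβ) ∈ τ.
    -- Every point of Ω has exactly |K| representatives, so this is
    -- |K| · c_{ρτ}^{t} whenever (Kα,Kβ) ∈ t.
    pathCount : SRep → SRep → V → V → ℕ
    pathCount ρ τ α β = count (λ w → InRel? ρ α w ×-dec InRel? τ w β) vecs

    record IsPermS (φ : SRep → SRep) : Set where
      field
        valid  : ∀ t → ValidS t → ValidS (φ t)
        resp   : ∀ t t′ → ValidS t → ValidS t′ → t ≈S t′ → φ t ≈S φ t′
        inj    : ∀ t t′ → ValidS t → ValidS t′ → φ t ≈S φ t′ → t ≈S t′
        surj   : ∀ t′ → ValidS t′ → Σ SRep (λ t → ValidS t × φ t ≈S t′)

    -- algebraic automorphism: c_{ρτ}^t = c_{ρ^φ τ^φ}^{t^φ} for all ρ,τ,t ∈ S,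
    -- where c_{ρτ}^t is evaluated at any (α,β) ∈ t.
    record IsAlgAut (φ : SRep → SRep) : Set where
      field
        perm  : IsPermS φ
        intNo : ∀ ρ τ t → ValidS ρ → ValidS τ → ValidS t →
                ∀ α β α′ β′ → NonZeroV α → NonZeroV β → NonZeroV α′ → NonZeroV β′ →
                InRel t α β → InRel (φ t) α′ β′ →
                pathCount ρ τ α β ≡ pathCount (φ ρ) (φ τ) α′ β′

    record IsAutC (σ : F → F) : Set where
      field
        valid : ∀ x → x ≢ 0# → σ x ≢ 0#
        resp  : ∀ x y → x ≢ 0# → y ≢ 0# → x ~ y → σ x ~ σ y
        hom   : ∀ x y → x ≢ 0# → y ≢ 0# → σ (x * y) ~ (σ x * σ y)
        inj   : ∀ x y → x ≢ 0# → y ≢ 0# → σ x ~ σ y → x ~ y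
        surj  : ∀ y → y ≢ 0# → Σ F (λ x → x ≢ 0# × σ x ~ y)

    φ[_,_] : (F → F) → F → SRep → SRep
    φ[ σ , g ] (rT , h) = (rT , σ h)
    φ[ σ , g ] (sT , h) = (sT , σ h * g)

-- Counting the w on a path α → w → β in the coordinates
-- X = det(w,γ), Y = det(α,w), a linear bijection of 𝔽² once det(α,γ) ≠ 0, splits every
-- intersection number into a product of two one-dimensional counts, each equal to 0, 1, |K| or q.
-- The resulting table depends on the indices only through equations such as c = ab in C, so it is
-- preserved by every φ_{σ,g}; here -1 ∈ K, a consequence of q(q-1)/n being even, makes the sign in
-- det(w,λα) = -λ det(α,w) invisible in C. Conversely the value q|K| occurs only in the entries
-- c_{s_a s_b}^{r_c}, so an algebraic automorphism φ maps r-relations to r-relations and s-relations to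
-- s-relations; the entries c_{r_a r_b}^{r_c} = [c = ab] make r_h ↦ r_{h^σ} an automorphism σ of C,
-- and the entries c_{r_h s_h}^{s_1} force s_h ↦ s_{h^σ g}, where s_1 ↦ s_g.

module Submission where

open import Level using (Level; 0ℓ)
open import Data.Nat as ℕ using (ℕ; zero; suc; _≤_; _<_; z≤n; s≤s)
import Data.Nat.Properties as ℕ
open import Data.Nat.Divisibility using (_∣_; _∣?_; divides)
open import Data.Nat.Primality using (Prime; prime[2]; euclidsLemma)
open import Data.Integer as ℤ using (ℤ; -[1+_])
import Data.Integer.Properties as ℤ
import Data.Sign as Sign
open import Data.Maybe using (Maybe; just; nothing)
open import Data.Product using (Σ; ∃; _×_; _,_; proj₁; proj₂)
open import Data.Sum using (_⊎_; inj₁; inj₂)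
open import Data.Unit using (⊤; tt)
open import Data.Fin using (toℕ)
import Data.Fin.Properties as Fin
open import Data.List using (List; []; _∷_; length; filter; cartesianProduct; map; _++_; lookup)
import Data.List.Properties as List
open import Data.List.Membership.Propositional using (_∈_; lose)
open import Data.List.Membership.Propositional.Properties using (∈-filter⁺; ∈-filter⁻; ∈-map⁻; ∈-cartesianProduct⁺)
open import Data.List.Relation.Unary.Unique.Propositional using (Unique)
import Data.List.Relation.Unary.Unique.Propositional.Properties as Unique
open import Data.List.Relation.Unary.Any as Any using (Any; here; there)
import Data.List.Relation.Unary.Any.Properties as AnyP
open import Data.List.Relation.Unary.All as All using (All; []; _∷_)
import Data.List.Relation.Unary.All.Properties as AllP
open import Data.List.Relation.Unary.AllPairs using ([]; _∷_)
open import Function using (_∘_; _⇔_; mk⇔; Equivalence)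
open import Function.Properties.Equivalence using (⇔-setoid)
open import Relation.Nullary using (¬_; Dec; yes; no; contradiction)
open import Relation.Nullary.Decidable using (_×-dec_; ¬?; map′)
open import Relation.Unary using (Pred; Decidable; _≐_; ∁; U)
open import Relation.Unary.Properties using (_∩?_; ∁?; _×?_; U?)
open import Relation.Binary using (DecidableEquality)
open import Relation.Binary.Bundles using (PartialSetoid)
open import Relation.Binary.PropositionalEquality using (_≡_; _≢_; refl; sym; trans; cong; cong₂; subst; subst₂; module ≡-Reasoning)
import Relation.Binary.Reasoning.PartialSetoid
import Relation.Binary.Reasoning.Setoid as SetoidReasoning
open import Algebra.Bundles using (CommutativeRing)
open import Algebra.Solver.Ring.AlmostCommutativeRing using (_-Raw-AlmostCommutative⟶_; fromCommutativeRing)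
open import Defs

-- The solver decides equality of coefficients by computation, which is impossible when an abstract
-- ring serves as its own coefficient ring; integers, interpreted as multiples of 1#, do compute.
module ℤ-CoefficientRingSolver {c ℓ : Level} (R : CommutativeRing c ℓ) where

  open CommutativeRing R renaming (refl to ≈-refl; sym to ≈-sym; trans to ≈-trans)
  open import Algebra.Properties.Ring ring using (-‿involutive; -0#≈0#; -‿+-comm; -1*x≈-x)
  open import Algebra.Properties.Semiring.Mult semiring using (×-homo-+; ×1-homo-*) renaming (_×_ to _×′_)
  open import Algebra.Properties.CommutativeSemigroup +-commutativeSemigroup using () renaming (interchange to +-interchange)
  open import Algebra.Properties.CommutativeSemigroup *-commutativeSemigroup using () renaming (interchange to *-interchange)
  open import Relation.Binary.Reasoning.Setoid setoid

  private
    ι : ℕ → Carrier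
    ι n = n ×′ 1#

    ⟦_⟧ : ℤ → Carrier
    ⟦ ℤ.+ n ⟧ = ι n
    ⟦ -[1+ n ] ⟧ = - ι (suc n)

    ⊖-homo : ∀ m n → ⟦ m ℤ.⊖ n ⟧ ≈ ι m - ι n
    ⊖-homo m zero = ≈-sym (≈-trans (+-congˡ -0#≈0#) (+-identityʳ _))
    ⊖-homo zero (suc n) = ≈-sym (+-identityˡ _)
    ⊖-homo (suc m) (suc n) = begin
      ⟦ suc m ℤ.⊖ suc n ⟧             ≡⟨ cong ⟦_⟧ (ℤ.[1+m]⊖[1+n]≡m⊖n m n) ⟩
      ⟦ m ℤ.⊖ n ⟧                     ≈⟨ ⊖-homo m n ⟩
      ι m - ι n                       ≈⟨ +-identityˡ _ ⟨
      0# + (ι m - ι n)                ≈⟨ +-congʳ (-‿inverseʳ 1#) ⟨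
      (1# - 1#) + (ι m - ι n)         ≈⟨ +-interchange 1# (- 1#) (ι m) (- ι n) ⟩
      (1# + ι m) + (- 1# - ι n)       ≈⟨ +-congˡ (-‿+-comm 1# (ι n)) ⟩
      ι (suc m) - ι (suc n)           ∎

    +-homo : ∀ i j → ⟦ i ℤ.+ j ⟧ ≈ ⟦ i ⟧ + ⟦ j ⟧
    +-homo -[1+ m ] -[1+ n ] = begin
      - ι (suc (suc (m ℕ.+ n)))       ≈⟨ -‿cong (+-congˡ (×-homo-+ 1# (suc m) n)) ⟩
      - (1# + (ι (suc m) + ι n))      ≈⟨ -‿cong (+-congˡ (+-comm (ι (suc m)) (ι n))) ⟩
      - (1# + (ι n + ι (suc m)))      ≈⟨ -‿cong (+-assoc 1# (ι n) _) ⟨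
      - (ι (suc n) + ι (suc m))       ≈⟨ -‿+-comm _ _ ⟨
      - ι (suc n) - ι (suc m)         ≈⟨ +-comm _ _ ⟩
      - ι (suc m) - ι (suc n)         ∎
    +-homo -[1+ m ] (ℤ.+ n) = ≈-trans (⊖-homo n (suc m)) (+-comm _ _)
    +-homo (ℤ.+ m) -[1+ n ] = ⊖-homo m (suc n)
    +-homo (ℤ.+ m) (ℤ.+ n) = ×-homo-+ 1# m n

    -‿homo : ∀ i → ⟦ ℤ.- i ⟧ ≈ - ⟦ i ⟧
    -‿homo (ℤ.+ zero) = ≈-sym -0#≈0#
    -‿homo (ℤ.+ suc n) = ≈-refl
    -‿homo -[1+ n ] = ≈-sym (-‿involutive _)

    sign : Sign.Sign → Carrier
    sign Sign.+ = 1#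
    sign Sign.- = - 1#

    sign-homo : ∀ s t → sign (s Sign.* t) ≈ sign s * sign t
    sign-homo Sign.+ t = ≈-sym (*-identityˡ _)
    sign-homo Sign.- Sign.+ = ≈-sym (*-identityʳ _)
    sign-homo Sign.- Sign.- = ≈-sym (≈-trans (-1*x≈-x _) (-‿involutive _))

    ◃-homo : ∀ s n → ⟦ s ℤ.◃ n ⟧ ≈ sign s * ι n
    ◃-homo s zero = ≈-sym (zeroʳ _)
    ◃-homo Sign.+ (suc n) = ≈-sym (*-identityˡ _)
    ◃-homo Sign.- (suc n) = ≈-sym (-1*x≈-x _)

    sign-abs : ∀ i → ⟦ i ⟧ ≈ sign (ℤ.sign i) * ι ℤ.∣ i ∣
    sign-abs (ℤ.+ n) = ≈-sym (*-identityˡ _)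
    sign-abs -[1+ n ] = ≈-sym (-1*x≈-x _)

    *-homo : ∀ i j → ⟦ i ℤ.* j ⟧ ≈ ⟦ i ⟧ * ⟦ j ⟧
    *-homo i j = begin
      ⟦ i ℤ.* j ⟧                                   ≈⟨ ◃-homo (s Sign.* t) (m ℕ.* n) ⟩
      sign (s Sign.* t) * ι (m ℕ.* n)               ≈⟨ *-cong (sign-homo s t) (×1-homo-* m n) ⟩
      (sign s * sign t) * (ι m * ι n)               ≈⟨ *-interchange _ _ _ _ ⟩
      (sign s * ι m) * (sign t * ι n)               ≈⟨ *-cong (sign-abs i) (sign-abs j) ⟨
      ⟦ i ⟧ * ⟦ j ⟧                                 ∎
      where
      s t : Sign.Sign
      s = ℤ.sign i
      t = ℤ.sign j
      m n : ℕ
      m = ℤ.∣ i ∣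
      n = ℤ.∣ j ∣

    homomorphism : ℤ.+-*-rawRing -Raw-AlmostCommutative⟶ fromCommutativeRing R
    homomorphism = record
      { ⟦_⟧ = ⟦_⟧ ; +-homo = +-homo ; *-homo = *-homo ; -‿homo = -‿homo
      ; 0-homo = ≈-refl ; 1-homo = +-identityʳ 1# }

    _≟ᶜ_ : ∀ i j → Maybe (⟦ i ⟧ ≈ ⟦ j ⟧)
    i ≟ᶜ j with i ℤ.≟ j
    ... | yes refl = just ≈-refl
    ... | no _ = nothing

  open import Algebra.Solver.Ring ℤ.+-*-rawRing (fromCommutativeRing R) homomorphism _≟ᶜ_ public
    using (solve; _:=_; _:+_; _:*_; :-_)

module _ {A : Set} where

  count-≐ : {P Q : Pred A 0ℓ} (P? : Decidable P) (Q? : Decidable Q) → P ≐ Q →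
    ∀ xs → count P? xs ≡ count Q? xs
  count-≐ P? Q? P≐Q xs = cong length (List.filter-≐ P? Q? P≐Q xs)

  count-none : {P : Pred A 0ℓ} (P? : Decidable P) → ∀ {xs} → All (∁ P) xs → count P? xs ≡ 0
  count-none P? none = cong length (List.filter-none P? none)

  count-empty : {P : Pred A 0ℓ} (P? : Decidable P) → (∀ x → ¬ P x) → ∀ xs → count P? xs ≡ 0
  count-empty P? ¬P xs = count-none P? (All.universal ¬P xs)

  count-all : {P : Pred A 0ℓ} (P? : Decidable P) → (∀ x → P x) → ∀ xs → count P? xs ≡ length xs
  count-all P? allP xs = cong length (List.filter-all P? (All.universal allP xs))

  count-pos : {P : Pred A 0ℓ} (P? : Decidable P) → ∀ {x xs} → x ∈ xs → P x → 0 < count P? xs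
  count-pos P? x∈xs px = List.filter-some P? (lose x∈xs px)

  count-witness : {P : Pred A 0ℓ} (P? : Decidable P) → ∀ xs → 0 < count P? xs → ∃ P
  count-witness P? (x ∷ xs) pos with P? x
  ... | yes px = x , px
  ... | no _ = count-witness P? xs pos

  count-split : {P : Pred A 0ℓ} (P? : Decidable P) {Q : Pred A 0ℓ} (Q? : Decidable Q) →
    ∀ xs → count P? xs ≡ count (P? ∩? Q?) xs ℕ.+ count (P? ∩? ∁? Q?) xs
  count-split P? Q? [] = refl
  count-split P? Q? (x ∷ xs) with P? x | Q? x
  ... | yes _ | yes _ = cong suc (count-split P? Q? xs)
  ... | yes _ | no _ = trans (cong suc (count-split P? Q? xs)) (sym (ℕ.+-suc _ _))
  ... | no _ | _ = count-split P? Q? xs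

  count-++ : {P : Pred A 0ℓ} (P? : Decidable P) → ∀ xs ys → count P? (xs ++ ys) ≡ count P? xs ℕ.+ count P? ys
  count-++ P? xs ys = trans (cong length (List.filter-++ P? xs ys)) (List.length-++ (filter P? xs))

  count-filter : {P R : Pred A 0ℓ} (P? : Decidable P) (R? : Decidable R) → (∀ {x} → P x → R x) →
    ∀ xs → count P? (filter R? xs) ≡ count P? xs
  count-filter P? R? P⊆R [] = refl
  count-filter P? R? P⊆R (x ∷ xs) with R? x
  ... | yes _ with P? x
  ...   | yes _ = cong suc (count-filter P? R? P⊆R xs)
  ...   | no _ = count-filter P? R? P⊆R xs
  count-filter P? R? P⊆R (x ∷ xs) | no ¬r with P? x
  ...   | yes p = contradiction (P⊆R p) ¬r
  ...   | no _ = count-filter P? R? P⊆R xs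

  module _ (_≟_ : DecidableEquality A) where

    count-≟ : ∀ {z xs} → Unique xs → z ∈ xs → count (_≟ z) xs ≡ 1
    count-≟ {z} {x ∷ xs} (x∉xs ∷ unique) z∈x∷xs with x ≟ z | z∈x∷xs
    ... | yes refl | _ = cong suc (count-none (_≟ z) (All.map (λ x≢y y≡x → x≢y (sym y≡x)) x∉xs))
    ... | no x≢z | here z≡x = contradiction (sym z≡x) x≢z
    ... | no _ | there z∈xs = count-≟ unique z∈xs

    Unique-length-≤ : ∀ {xs ys} → Unique xs → (∀ {x} → x ∈ xs → x ∈ ys) → length xs ≤ length ys
    Unique-length-≤ {[]} _ _ = z≤n
    Unique-length-≤ {x ∷ xs} {ys} (x∉xs ∷ unique) xs⊆ys = ℕ.≤-trans (s≤s IH) ys-without-x<ys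
      where
      ys-without-x : List A
      ys-without-x = filter (λ y → ¬? (x ≟ y)) ys
      IH : length xs ≤ length ys-without-x
      IH = Unique-length-≤ unique (λ y∈xs → ∈-filter⁺ (λ y → ¬? (x ≟ y)) (xs⊆ys (there y∈xs)) (All.lookup x∉xs y∈xs))
      ys-without-x<ys : length ys-without-x < length ys
      ys-without-x<ys = List.filter-notAll (λ y → ¬? (x ≟ y)) ys (Any.map (λ x≡y x≢y → x≢y x≡y) (xs⊆ys (here refl)))

module _ {A B : Set} {P : Pred A 0ℓ} (f : A → B) (inj : ∀ {x x′} → P x → P x′ → f x ≡ f x′ → x ≡ x′) where

  map-Unique-on : ∀ {xs} → Unique xs → All P xs → Unique (map f xs)
  map-Unique-on {[]} [] [] = []
  map-Unique-on {x ∷ xs} (x∉xs ∷ unique) (px ∷ pxs) =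
    AllP.map⁺ (All.zipWith (λ (x≢y , py) fx≡fy → x≢y (inj px py fx≡fy)) (x∉xs , pxs)) ∷ map-Unique-on unique pxs

module _ {A B : Set} {P : Pred A 0ℓ} {Q : Pred B 0ℓ} (P? : Decidable P) (Q? : Decidable Q) where

  count-≤-injection : DecidableEquality B → ∀ {xs ys} → Unique xs → (∀ {y} → Q y → y ∈ ys) →
    (f : A → B) → (∀ {x} → P x → Q (f x)) → (∀ {x x′} → P x → P x′ → f x ≡ f x′ → x ≡ x′) →
    count P? xs ≤ count Q? ys
  count-≤-injection _≟_ {xs} {ys} unique complete f PQ inj =
    subst (_≤ count Q? ys) (List.length-map f (filter P? xs)) (Unique-length-≤ _≟_ image-unique image⊆Q)
    where
    image-unique : Unique (map f (filter P? xs))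
    image-unique = map-Unique-on f inj (Unique.filter⁺ P? unique) (All.tabulate (λ x∈ → proj₂ (∈-filter⁻ P? {xs = xs} x∈)))
    image⊆Q : ∀ {y} → y ∈ map f (filter P? xs) → y ∈ filter Q? ys
    image⊆Q y∈image with ∈-map⁻ f y∈image
    ... | x , x∈ , refl = let px = proj₂ (∈-filter⁻ P? {xs = xs} x∈) in ∈-filter⁺ Q? (complete (PQ px)) (PQ px)

  count-cartesianProduct : ∀ xs ys → count (P? ×? Q?) (cartesianProduct xs ys) ≡ count P? xs ℕ.* count Q? ys
  count-cartesianProduct [] ys = refl
  count-cartesianProduct (x ∷ xs) ys with P? x
  ... | yes px = trans (count-++ (P? ×? Q?) (map (x ,_) ys) _) (cong₂ ℕ._+_ (row ys) (count-cartesianProduct xs ys))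
    where
    row : ∀ ys → count (P? ×? Q?) (map (x ,_) ys) ≡ count Q? ys
    row [] = refl
    row (y ∷ ys) with P? x | Q? y
    ... | yes _ | yes _ = cong suc (row ys)
    ... | yes _ | no _ = row ys
    ... | no ¬px | _ = contradiction px ¬px
  ... | no ¬px = trans (count-++ (P? ×? Q?) (map (x ,_) ys) _)
    (cong₂ ℕ._+_ (count-none (P? ×? Q?) (AllP.map⁺ (All.universal (λ _ pq → ¬px (proj₁ pq)) ys)))
                 (count-cartesianProduct xs ys))

module _ {A B : Set} {P : Pred A 0ℓ} {Q : Pred B 0ℓ} (P? : Decidable P) (Q? : Decidable Q) where

  count-≡-bijection : DecidableEquality A → DecidableEquality B → ∀ {xs ys} → Unique xs → Unique ys →
    (∀ {x} → P x → x ∈ xs) → (∀ {y} → Q y → y ∈ ys) →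
    (f : A → B) (g : B → A) → (∀ {x} → P x → Q (f x)) → (∀ {y} → Q y → P (g y)) →
    (∀ {x} → P x → g (f x) ≡ x) → (∀ {y} → Q y → f (g y) ≡ y) → count P? xs ≡ count Q? ys
  count-≡-bijection _≟A_ _≟B_ xs-unique ys-unique xs-complete ys-complete f g PQ QP gf fg = ℕ.≤-antisym
    (count-≤-injection P? Q? _≟B_ xs-unique ys-complete f PQ
      (λ px px′ fx≡fx′ → trans (sym (gf px)) (trans (cong g fx≡fx′) (gf px′))))
    (count-≤-injection Q? P? _≟A_ ys-unique xs-complete g QP
      (λ qy qy′ gy≡gy′ → trans (sym (fg qy)) (trans (cong f gy≡gy′) (fg qy′))))

¬2∣odd : ∀ c → ¬ 2 ∣ suc (c ℕ.+ c)
¬2∣odd c (divides j 1+2c≡j*2) =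
  ℕ.even≢odd j c (trans (ℕ.*-comm 2 j) (trans (sym 1+2c≡j*2) (cong (λ c′ → suc (c ℕ.+ c′)) (sym (ℕ.+-identityʳ c)))))

module Enumeration {A : Set} (_≟_ : DecidableEquality A) {elems : List A}
  (unique : Unique elems) (complete : ∀ x → x ∈ elems) where

  injection-onto : {P : Pred A 0ℓ} (P? : Decidable P) (f : A → A) → (∀ {x} → P x → P (f x)) →
    (∀ {x x′} → P x → P x′ → f x ≡ f x′ → x ≡ x′) → ∀ {y} → P y → ∃ λ x → P x × f x ≡ y
  injection-onto {P} P? f PP inj {y} py with 0 ℕ.<? count (P? ∩? (λ x → f x ≟ y)) elems
  ... | yes pos = count-witness (P? ∩? (λ x → f x ≟ y)) elems pos
  ... | no ¬pos = contradiction P≤P∖y (ℕ.<⇒≱ P∖y<P)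
    where
    misses : ∀ {x} → P x → f x ≢ y
    misses px fx≡y = ¬pos (count-pos (P? ∩? (λ x → f x ≟ y)) (complete _) (px , fx≡y))
    P≤P∖y : count P? elems ≤ count (P? ∩? ∁? (_≟ y)) elems
    P≤P∖y = count-≤-injection P? (P? ∩? ∁? (_≟ y)) _≟_ unique (λ _ → complete _) f
      (λ px → PP px , misses px) inj
    P∖y<P : count (P? ∩? ∁? (_≟ y)) elems < count P? elems
    P∖y<P = subst (count (P? ∩? ∁? (_≟ y)) elems <_) (sym (count-split P? (_≟ y) elems))
      (ℕ.m<n+m _ (count-pos (P? ∩? (_≟ y)) (complete y) (py , refl)))

  private
    position : A → ℕ
    position x = toℕ (Any.index (complete x))

    position-injective : ∀ {x y} → position x ≡ position y → x ≡ y
    position-injective {x} {y} eq = begin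
      x                                      ≡⟨ AnyP.lookup-index (complete x) ⟩
      lookup elems (Any.index (complete x))  ≡⟨ cong (lookup elems) (Fin.toℕ-injective eq) ⟩
      lookup elems (Any.index (complete y))  ≡⟨ AnyP.lookup-index (complete y) ⟨
      y                                      ∎
      where open ≡-Reasoning

  -- The non-fixed points are paired up by f; f swaps those that precede their image with those that follow it.
  involution-count-odd : {P : Pred A 0ℓ} (P? : Decidable P) (f : A → A) (z : A) →
    (∀ {x} → P x → P (f x)) → (∀ {x} → P x → f (f x) ≡ x) → P z → f z ≡ z →
    (∀ {x} → P x → f x ≡ x → x ≡ z) → ¬ 2 ∣ count P? elems
  involution-count-odd {P} P? f z PP involutive pz fz≡z fixed⇒z = subst (λ n → ¬ 2 ∣ n) (sym P≡1+2c) (¬2∣odd c)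
    where
    moved? : Decidable (λ x → P x × x ≢ z)
    moved? = P? ∩? ∁? (_≟ z)
    up? : Decidable (λ x → (P x × x ≢ z) × position x < position (f x))
    up? = moved? ∩? (λ x → position x ℕ.<? position (f x))
    down? : Decidable (λ x → (P x × x ≢ z) × ¬ position x < position (f x))
    down? = moved? ∩? ∁? (λ x → position x ℕ.<? position (f x))
    c : ℕ
    c = count up? elems
    stays-moved : ∀ {x} → P x × x ≢ z → P (f x) × f x ≢ z
    stays-moved (px , x≢z) = PP px , λ fx≡z → x≢z (trans (sym (involutive px)) (trans (cong f fx≡z) fz≡z))
    up≡down : count up? elems ≡ count down? elems
    up≡down = count-≡-bijection up? down? _≟_ _≟_ unique unique (λ _ → complete _) (λ _ → complete _) f f
      (λ (moved , x<fx) → stays-moved moved ,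
          λ fx<ffx → ℕ.<-asym x<fx (subst (λ w → position (f _) < position w) (involutive (proj₁ moved)) fx<ffx))
      (λ {x} (moved , x≮fx) → stays-moved moved , subst (λ w → position (f x) < position w) (sym (involutive (proj₁ moved)))
          (ℕ.≤∧≢⇒< (ℕ.≮⇒≥ x≮fx) (λ eq → proj₂ moved (fixed⇒z (proj₁ moved) (position-injective eq)))))
      (λ ((px , _) , _) → involutive px) (λ ((px , _) , _) → involutive px)
    z-once : count (P? ∩? (_≟ z)) elems ≡ 1
    z-once = trans (count-≐ (P? ∩? (_≟ z)) (_≟ z) (proj₂ , λ { refl → pz , refl }) elems) (count-≟ _≟_ unique (complete z))
    P≡1+2c : count P? elems ≡ suc (c ℕ.+ c)
    P≡1+2c = begin
      count P? elems                                            ≡⟨ count-split P? (_≟ z) elems ⟩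
      count (P? ∩? (_≟ z)) elems ℕ.+ count moved? elems         ≡⟨ cong₂ ℕ._+_ z-once (count-split moved? _ elems) ⟩
      suc (c ℕ.+ count down? elems)                             ≡⟨ cong (λ d → suc (c ℕ.+ d)) up≡down ⟨
      suc (c ℕ.+ c)                                             ∎
      where open ≡-Reasoning

when : {C : Set} → Dec C → ℕ → ℕ
when (yes _) v = v
when (no _) _ = 0

×-⇔-interchange : {P Q A B C D : Set} → P ⇔ (A × B) → Q ⇔ (C × D) → (P × Q) ⇔ ((A × C) × (B × D))
×-⇔-interchange P⇔A×B Q⇔C×D = mk⇔
  (λ (p , q) → let (a , b) = to P⇔A×B p ; (c , d) = to Q⇔C×D q in (a , c) , (b , d))
  (λ ((a , c) , (b , d)) → from P⇔A×B (a , b) , from Q⇔C×D (c , d))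
  where open Equivalence

*-when : ∀ m {C : Set} (C? : Dec C) v → m ℕ.* when C? v ≡ when C? (m ℕ.* v)
*-when m (yes _) v = refl
*-when m (no _) v = ℕ.*-zeroʳ m

when-yes : {C : Set} (C? : Dec C) → C → ∀ v → when C? v ≡ v
when-yes (yes _) _ v = refl
when-yes (no ¬c) c v = contradiction c ¬c

when-pos : {C : Set} (C? : Dec C) → ∀ {v} → 0 < when C? v → C
when-pos (yes c) _ = c

when-≤ : {C : Set} (C? : Dec C) → ∀ v → when C? v ≤ v
when-≤ (yes _) v = ℕ.≤-refl
when-≤ (no _) v = z≤n

when-cong : {C D : Set} (C? : Dec C) (D? : Dec D) → C ⇔ D → ∀ v → when C? v ≡ when D? v
when-cong (yes _) (yes _) _ v = refl
when-cong (yes c) (no ¬d) C⇔D v = contradiction (Equivalence.to C⇔D c) ¬d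
when-cong (no ¬c) (yes d) C⇔D v = contradiction (Equivalence.from C⇔D d) ¬c
when-cong (no _) (no _) _ v = refl

module FieldProperties (𝔽 : FiniteField) where
  open FiniteField 𝔽

  commutativeRing : CommutativeRing 0ℓ 0ℓ
  commutativeRing = record { isCommutativeRing = isCommutativeRing }

  open CommutativeRing commutativeRing public
    using (+-assoc; +-comm; +-identityˡ; +-identityʳ; -‿inverseʳ;
           *-assoc; *-comm; *-identityˡ; *-identityʳ; zeroˡ; zeroʳ)
  open import Algebra.Properties.Ring (CommutativeRing.ring commutativeRing) public
    using (-‿involutive; -0#≈0#; -1*x≈-x)
  open import Algebra.Properties.CommutativeSemigroup (CommutativeRing.*-commutativeSemigroup commutativeRing) public
    using () renaming (interchange to *-interchange)
  open ℤ-CoefficientRingSolver commutativeRing public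
  open Enumeration _≟_ elems-unique elems-complete public
  open ≡-Reasoning

  1≢0 : 1# ≢ 0#
  1≢0 1≡0 = 0≢1 (sym 1≡0)

  inverseˡ : ∀ {x} → x ≢ 0# → x ⁻¹ * x ≡ 1#
  inverseˡ {x} x≢0 = trans (*-comm _ _) (inverseʳ x x≢0)

  x⁻¹*[x*y]≡y : ∀ {x} → x ≢ 0# → ∀ y → x ⁻¹ * (x * y) ≡ y
  x⁻¹*[x*y]≡y {x} x≢0 y = begin
    x ⁻¹ * (x * y)   ≡⟨ *-assoc _ _ _ ⟨
    (x ⁻¹ * x) * y   ≡⟨ cong (_* y) (inverseˡ x≢0) ⟩
    1# * y           ≡⟨ *-identityˡ y ⟩
    y                ∎

  x*[x⁻¹*y]≡y : ∀ {x} → x ≢ 0# → ∀ y → x * (x ⁻¹ * y) ≡ y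
  x*[x⁻¹*y]≡y {x} x≢0 y = begin
    x * (x ⁻¹ * y)   ≡⟨ *-assoc _ _ _ ⟨
    (x * x ⁻¹) * y   ≡⟨ cong (_* y) (inverseʳ x x≢0) ⟩
    1# * y           ≡⟨ *-identityˡ y ⟩
    y                ∎

  *-cancelˡ : ∀ {x y z} → x ≢ 0# → x * y ≡ x * z → y ≡ z
  *-cancelˡ {x} {y} {z} x≢0 xy≡xz = begin
    y               ≡⟨ x⁻¹*[x*y]≡y x≢0 y ⟨
    x ⁻¹ * (x * y)  ≡⟨ cong (x ⁻¹ *_) xy≡xz ⟩
    x ⁻¹ * (x * z)  ≡⟨ x⁻¹*[x*y]≡y x≢0 z ⟩
    z               ∎

  x*y≢0 : ∀ {x y} → x ≢ 0# → y ≢ 0# → x * y ≢ 0#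
  x*y≢0 {x} x≢0 y≢0 xy≡0 = y≢0 (*-cancelˡ x≢0 (trans xy≡0 (sym (zeroʳ x))))

  x*y≢0⇒x≢0 : ∀ {x y} → x * y ≢ 0# → x ≢ 0#
  x*y≢0⇒x≢0 {y = y} xy≢0 refl = xy≢0 (zeroˡ y)

  ⁻¹-unique : ∀ {x y} → x * y ≡ 1# → x ⁻¹ ≡ y
  ⁻¹-unique {x} {y} xy≡1 = *-cancelˡ x≢0 (trans (inverseʳ x x≢0) (sym xy≡1))
    where
    x≢0 : x ≢ 0#
    x≢0 refl = 0≢1 (trans (sym (zeroˡ y)) xy≡1)

  x⁻¹≢0 : ∀ {x} → x ≢ 0# → x ⁻¹ ≢ 0#
  x⁻¹≢0 {x} x≢0 x⁻¹≡0 = 0≢1 (trans (sym (zeroʳ x)) (trans (cong (x *_) (sym x⁻¹≡0)) (inverseʳ x x≢0)))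

  ⁻¹-involutive : ∀ {x} → x ≢ 0# → x ⁻¹ ⁻¹ ≡ x
  ⁻¹-involutive x≢0 = ⁻¹-unique (inverseˡ x≢0)

  ⁻¹-distrib-* : ∀ {x y} → x ≢ 0# → y ≢ 0# → (x * y) ⁻¹ ≡ x ⁻¹ * y ⁻¹
  ⁻¹-distrib-* {x} {y} x≢0 y≢0 = ⁻¹-unique (begin
    (x * y) * (x ⁻¹ * y ⁻¹)  ≡⟨ *-interchange x y (x ⁻¹) (y ⁻¹) ⟩
    (x * x ⁻¹) * (y * y ⁻¹)  ≡⟨ cong₂ _*_ (inverseʳ x x≢0) (inverseʳ y y≢0) ⟩
    1# * 1#                  ≡⟨ *-identityˡ 1# ⟩
    1#                       ∎)

  1⁻¹≡1 : 1# ⁻¹ ≡ 1#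
  1⁻¹≡1 = ⁻¹-unique (*-identityˡ 1#)

  -x≡0⇒x≡0 : ∀ {x} → - x ≡ 0# → x ≡ 0#
  -x≡0⇒x≡0 {x} -x≡0 = trans (sym (-‿involutive x)) (trans (cong -_ -x≡0) -0#≈0#)

  x*x≡1⇒x≡±1 : ∀ {x} → x * x ≡ 1# → x ≡ 1# ⊎ x ≡ - 1#
  x*x≡1⇒x≡±1 {x} x²≡1 with (x + - 1#) ≟ 0#
  ... | yes x-1≡0 = inj₁ (begin
    x                ≡⟨ solve 2 (λ x o → x := (x :+ :- o) :+ o) refl x 1# ⟩
    (x + - 1#) + 1#  ≡⟨ cong (_+ 1#) x-1≡0 ⟩
    0# + 1#          ≡⟨ +-identityˡ 1# ⟩
    1#               ∎)
  ... | no x-1≢0 = inj₂ (begin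
    x                ≡⟨ solve 2 (λ x o → x := (x :+ o) :+ :- o) refl x 1# ⟩
    (x + 1#) + - 1#  ≡⟨ cong (_+ - 1#) x+1≡0 ⟩
    0# + - 1#        ≡⟨ +-identityˡ _ ⟩
    - 1#             ∎)
    where
    x+1≡0 : x + 1# ≡ 0#
    x+1≡0 = *-cancelˡ x-1≢0 (begin
      (x + - 1#) * (x + 1#)  ≡⟨ solve 2 (λ x o → (x :+ :- o) :* (x :+ o) := x :* x :+ :- (o :* o)) refl x 1# ⟩
      x * x + - (1# * 1#)    ≡⟨ cong₂ (λ a b → a + - b) x²≡1 (*-identityˡ 1#) ⟩
      1# + - 1#              ≡⟨ -‿inverseʳ 1# ⟩
      0#                     ≡⟨ zeroʳ _ ⟨
      (x + - 1#) * 0#        ∎)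

  -- Otherwise x ↦ -x would be an involution of 𝔽 fixing only 0, forcing q to be odd.
  even-order⇒1+1≡0 : 2 ∣ order → 1# + 1# ≡ 0#
  even-order⇒1+1≡0 2∣q with (1# + 1#) ≟ 0#
  ... | yes 1+1≡0 = 1+1≡0
  ... | no 1+1≢0 = contradiction (subst (2 ∣_) (sym (count-all U? (λ _ → _) elems)) 2∣q)
    (involution-count-odd U? -_ 0# _ (λ {x} _ → -‿involutive x) _ -0#≈0# only-0-fixed)
    where
    only-0-fixed : ∀ {x} → U x → - x ≡ x → x ≡ 0#
    only-0-fixed {x} _ -x≡x with x ≟ 0#
    ... | yes x≡0 = x≡0
    ... | no x≢0 = contradiction (begin
      (1# + 1#) * x    ≡⟨ solve 2 (λ o x → (o :+ o) :* x := o :* x :+ o :* x) refl 1# x ⟩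
      1# * x + 1# * x  ≡⟨ cong₂ _+_ (*-identityˡ x) (*-identityˡ x) ⟩
      x + x            ≡⟨ cong (x +_) -x≡x ⟨
      x + - x          ≡⟨ -‿inverseʳ x ⟩
      0#               ∎) (x*y≢0 1+1≢0 x≢0)

  2≤order : 2 ℕ.≤ order
  2≤order = subst (2 ℕ.≤_) (trans (sym (count-split U? (_≟ 0#) elems)) (count-all U? (λ _ → _) elems))
    (ℕ.+-mono-≤ (count-pos (U? ∩? (_≟ 0#)) (elems-complete 0#) (_ , refl))
                (count-pos (U? ∩? ∁? (_≟ 0#)) (elems-complete 1#) (_ , 1≢0)))

module PlaneProperties (𝔽 : FiniteField) where
  open FiniteField 𝔽
  open FieldProperties 𝔽
  open Tatra 𝔽
  open ≡-Reasoning

  vecs-unique : Unique vecs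
  vecs-unique = Unique.filter⁺ nzV? (Unique.cartesianProduct⁺ elems-unique elems-unique)

  vecs-complete : ∀ {v} → NonZeroV v → v ∈ vecs
  vecs-complete {a , b} = ∈-filter⁺ nzV? (∈-cartesianProduct⁺ (elems-complete a) (elems-complete b))

  ·-assoc : ∀ a b v → a · (b · v) ≡ (a * b) · v
  ·-assoc a b (v₁ , v₂) = cong₂ _,_ (sym (*-assoc a b v₁)) (sym (*-assoc a b v₂))

  ·-identityˡ : ∀ v → 1# · v ≡ v
  ·-identityˡ (v₁ , v₂) = cong₂ _,_ (*-identityˡ v₁) (*-identityˡ v₂)

  ·-cancelʳ : ∀ {a b v} → NonZeroV v → a · v ≡ b · v → a ≡ b
  ·-cancelʳ {a} {b} {v₁ , v₂} v≢0 av≡bv with v₁ ≟ 0# | v₂ ≟ 0#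
  ... | yes v₁≡0 | yes v₂≡0 = contradiction (v₁≡0 , v₂≡0) v≢0
  ... | no v₁≢0 | _ = *-cancelˡ v₁≢0 (trans (*-comm v₁ a) (trans (cong proj₁ av≡bv) (*-comm b v₁)))
  ... | yes _ | no v₂≢0 = *-cancelˡ v₂≢0 (trans (*-comm v₂ a) (trans (cong proj₂ av≡bv) (*-comm b v₂)))

  ·-nonzero : ∀ {a v} → a ≢ 0# → NonZeroV v → NonZeroV (a · v)
  ·-nonzero {a} a≢0 v≢0 (av₁≡0 , av₂≡0) =
    v≢0 (*-cancelˡ a≢0 (trans av₁≡0 (sym (zeroʳ a))) , *-cancelˡ a≢0 (trans av₂≡0 (sym (zeroʳ a))))

  det≢0⇒nonzeroʳ : ∀ {u w} → det u w ≢ 0# → NonZeroV w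
  det≢0⇒nonzeroʳ {u₁ , u₂} {w₁ , w₂} det≢0 (refl , refl) =
    det≢0 (trans (cong₂ (λ a b → a + - b) (zeroʳ u₁) (zeroʳ u₂)) (trans (cong (0# +_) -0#≈0#) (+-identityˡ 0#)))

  det-·ʳ : ∀ w λ′ α → det w (λ′ · α) ≡ - (λ′ * det α w)
  det-·ʳ (w₁ , w₂) λ′ (a₁ , a₂) =
    solve 5 (λ w₁ w₂ l a₁ a₂ → w₁ :* (l :* a₂) :+ :- (w₂ :* (l :* a₁)) := :- (l :* (a₁ :* w₂ :+ :- (a₂ :* w₁))))
      refl w₁ w₂ λ′ a₁ a₂

  complement : ∀ {α} → NonZeroV α → Σ V λ γ → det α γ ≢ 0#
  complement {a₁ , a₂} α≢0 with a₁ ≟ 0#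
  ... | yes a₁≡0 = (1# , 0#) , λ det≡0 → α≢0 (a₁≡0 , (begin
    a₂                       ≡⟨ *-identityʳ a₂ ⟨
    a₂ * 1#                  ≡⟨ -x≡0⇒x≡0 (trans (sym (+-identityˡ _)) (trans (cong (_+ - (a₂ * 1#)) (sym (zeroʳ a₁))) det≡0)) ⟩
    0#                       ∎))
  ... | no a₁≢0 = (0# , 1#) , λ det≡0 → a₁≢0 (begin
    a₁                       ≡⟨ *-identityʳ a₁ ⟨
    a₁ * 1#                  ≡⟨ +-identityʳ _ ⟨
    a₁ * 1# + 0#             ≡⟨ cong (a₁ * 1# +_) (trans (cong -_ (zeroʳ a₂)) -0#≈0#) ⟨
    a₁ * 1# + - (a₂ * 0#)    ≡⟨ det≡0 ⟩
    0#                       ∎)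

  cramer₁ : ∀ u γ w → det u γ * proj₁ w ≡ det w γ * proj₁ u + det u w * proj₁ γ
  cramer₁ (u₁ , u₂) (γ₁ , γ₂) (w₁ , w₂) =
    solve 6 (λ u₁ u₂ γ₁ γ₂ w₁ w₂ → (u₁ :* γ₂ :+ :- (u₂ :* γ₁)) :* w₁
                                 := (w₁ :* γ₂ :+ :- (w₂ :* γ₁)) :* u₁ :+ (u₁ :* w₂ :+ :- (u₂ :* w₁)) :* γ₁)
      refl u₁ u₂ γ₁ γ₂ w₁ w₂

  cramer₂ : ∀ u γ w → det u γ * proj₂ w ≡ det w γ * proj₂ u + det u w * proj₂ γ
  cramer₂ (u₁ , u₂) (γ₁ , γ₂) (w₁ , w₂) =
    solve 6 (λ u₁ u₂ γ₁ γ₂ w₁ w₂ → (u₁ :* γ₂ :+ :- (u₂ :* γ₁)) :* w₂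
                                 := (w₁ :* γ₂ :+ :- (w₂ :* γ₁)) :* u₂ :+ (u₁ :* w₂ :+ :- (u₂ :* w₁)) :* γ₂)
      refl u₁ u₂ γ₁ γ₂ w₁ w₂

  private
    solve-for : ∀ {e x r} → e ≢ 0# → e * x ≡ r → x ≡ e ⁻¹ * r
    solve-for {e} {x} e≢0 ex≡r = trans (sym (x⁻¹*[x*y]≡y e≢0 x)) (cong (e ⁻¹ *_) ex≡r)

  det[u,w]≡0⇒w≡·u : ∀ {u γ w} → det u γ ≢ 0# → det u w ≡ 0# → w ≡ (det u γ ⁻¹ * det w γ) · u
  det[u,w]≡0⇒w≡·u {u} {γ} {w} E≢0 Y≡0 = cong₂ _,_ (coordinate (cramer₁ u γ w)) (coordinate (cramer₂ u γ w))
    where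
    coordinate : ∀ {x a b} → det u γ * x ≡ det w γ * a + det u w * b → x ≡ (det u γ ⁻¹ * det w γ) * a
    coordinate {x} {a} {b} cramer = trans (solve-for E≢0 (begin
      det u γ * x                    ≡⟨ cramer ⟩
      det w γ * a + det u w * b      ≡⟨ cong (λ y → det w γ * a + y * b) Y≡0 ⟩
      det w γ * a + 0# * b           ≡⟨ cong (det w γ * a +_) (zeroˡ b) ⟩
      det w γ * a + 0#               ≡⟨ +-identityʳ _ ⟩
      det w γ * a                    ∎)) (sym (*-assoc _ _ _))

  det[w,γ]≡0⇒w≡·γ : ∀ {u γ w} → det u γ ≢ 0# → det w γ ≡ 0# → w ≡ (det u γ ⁻¹ * det u w) · γ
  det[w,γ]≡0⇒w≡·γ {u} {γ} {w} E≢0 X≡0 = cong₂ _,_ (coordinate (cramer₁ u γ w)) (coordinate (cramer₂ u γ w))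
    where
    coordinate : ∀ {x a b} → det u γ * x ≡ det w γ * a + det u w * b → x ≡ (det u γ ⁻¹ * det u w) * b
    coordinate {x} {a} {b} cramer = trans (solve-for E≢0 (begin
      det u γ * x                    ≡⟨ cramer ⟩
      det w γ * a + det u w * b      ≡⟨ cong (λ y → y * a + det u w * b) X≡0 ⟩
      0# * a + det u w * b           ≡⟨ cong (_+ det u w * b) (zeroˡ a) ⟩
      0# + det u w * b               ≡⟨ +-identityˡ _ ⟩
      det u w * b                    ∎)) (sym (*-assoc _ _ _))

  -- For det(u,γ) ≠ 0, the map w ↦ (det(w,γ), det(u,w)) is a linear bijection of 𝔽².
  count-by-coordinates : ∀ {u γ} → det u γ ≢ 0# →
    {Π : Pred V 0ℓ} (Π? : Decidable Π) {A B : Pred F 0ℓ} (A? : Decidable A) (B? : Decidable B) →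
    (∀ w → Π w ⇔ (A (det w γ) × B (det u w))) → (∀ {w} → Π w → NonZeroV w) →
    count Π? vecs ≡ count A? elems ℕ.* count B? elems
  count-by-coordinates {u₁ , u₂} {γ₁ , γ₂} E≢0 {Π} Π? {A} {B} A? B? Π⇔A×B Π⇒nonzero = begin
    count Π? vecs                                    ≡⟨ count-≡-bijection Π? (A? ×? B?) _≟V_ _≟V_ vecs-unique vecs-unique
                                                          (vecs-complete ∘ Π⇒nonzero) (vecs-complete ∘ AB⇒nonzero)
                                                          coordinates from-coordinates (Equivalence.to (Π⇔A×B _)) AB⇒Π
                                                          (λ _ → from∘to _) (λ _ → to∘from _) ⟩
    count (A? ×? B?) vecs                            ≡⟨ count-filter (A? ×? B?) nzV? AB⇒nonzero (cartesianProduct elems elems) ⟩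
    count (A? ×? B?) (cartesianProduct elems elems)  ≡⟨ count-cartesianProduct A? B? elems elems ⟩
    count A? elems ℕ.* count B? elems                ∎
    where
    u γ : V
    u = u₁ , u₂
    γ = γ₁ , γ₂
    E : F
    E = det u γ
    coordinates : V → V
    coordinates w = det w γ , det u w
    from-coordinates : V → V
    from-coordinates (X , Y) = E ⁻¹ * (X * u₁ + Y * γ₁) , E ⁻¹ * (X * u₂ + Y * γ₂)
    from∘to : ∀ w → from-coordinates (coordinates w) ≡ w
    from∘to w = sym (cong₂ _,_ (solve-for E≢0 (cramer₁ u γ w)) (solve-for E≢0 (cramer₂ u γ w)))
    to∘from : ∀ z → coordinates (from-coordinates z) ≡ z
    to∘from (X , Y) = cong₂ _,_
      (trans (solve 7 (λ u₁ u₂ γ₁ γ₂ X Y i → (i :* (X :* u₁ :+ Y :* γ₁)) :* γ₂ :+ :- ((i :* (X :* u₂ :+ Y :* γ₂)) :* γ₁)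
                                           := (i :* (u₁ :* γ₂ :+ :- (u₂ :* γ₁))) :* X) refl u₁ u₂ γ₁ γ₂ X Y (E ⁻¹))
             (trans (cong (_* X) (inverseˡ E≢0)) (*-identityˡ X)))
      (trans (solve 7 (λ u₁ u₂ γ₁ γ₂ X Y i → u₁ :* (i :* (X :* u₂ :+ Y :* γ₂)) :+ :- (u₂ :* (i :* (X :* u₁ :+ Y :* γ₁)))
                                           := (i :* (u₁ :* γ₂ :+ :- (u₂ :* γ₁))) :* Y) refl u₁ u₂ γ₁ γ₂ X Y (E ⁻¹))
             (trans (cong (_* Y) (inverseˡ E≢0)) (*-identityˡ Y)))
    AB⇒Π : ∀ {z} → A (proj₁ z) × B (proj₂ z) → Π (from-coordinates z)
    AB⇒Π {z} ab = Equivalence.from (Π⇔A×B _) (subst (λ c → A (proj₁ c) × B (proj₂ c)) (sym (to∘from z)) ab)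
    from-0 : ∀ a b → E ⁻¹ * (0# * a + 0# * b) ≡ 0#
    from-0 a b = trans (cong (E ⁻¹ *_) (trans (cong₂ _+_ (zeroˡ a) (zeroˡ b)) (+-identityˡ 0#))) (zeroʳ _)
    AB⇒nonzero : ∀ {z} → A (proj₁ z) × B (proj₂ z) → NonZeroV z
    AB⇒nonzero ab (refl , refl) = Π⇒nonzero (AB⇒Π ab) (from-0 u₁ γ₁ , from-0 u₂ γ₂)

module CosetProperties (𝔽 : FiniteField) {n : ℕ} (H : Tatra.Subgroup 𝔽 n) where
  open FiniteField 𝔽
  open FieldProperties 𝔽
  open Tatra 𝔽
  open Subgroup H
  open WithK H
  open PlaneProperties 𝔽
  open ≡-Reasoning

  ∣K∣ : ℕ
  ∣K∣ = count K? elems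

  K-inv : ∀ {x} → K x → K (x ⁻¹)
  K-inv {x} x∈K with injection-onto K? (x *_) (K-mul x∈K) (λ _ _ → *-cancelˡ (K-nonzero x∈K)) K-one
  ... | y , y∈K , xy≡1 = subst K (sym (⁻¹-unique xy≡1)) y∈K

  -- Equality in C = 𝔽*/K; unlike _~_ it also requires both representatives to be nonzero.
  infix 4 _≃_ _≃?_
  record _≃_ (x y : F) : Set where
    constructor mk≃
    field
      nonzeroˡ : x ≢ 0#
      nonzeroʳ : y ≢ 0#
      ratio∈K  : x ~ y
  open _≃_ public

  _≃?_ : ∀ x y → Dec (x ≃ y)
  x ≃? y = map′ (λ (x≢0 , y≢0 , r) → mk≃ x≢0 y≢0 r) (λ (mk≃ x≢0 y≢0 r) → x≢0 , y≢0 , r)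
    (¬? (x ≟ 0#) ×-dec (¬? (y ≟ 0#) ×-dec (x ~? y)))

  ~⇒≃ : ∀ {x y} → y ≢ 0# → x ~ y → x ≃ y
  ~⇒≃ y≢0 r = mk≃ (x*y≢0⇒x≢0 (K-nonzero r)) y≢0 r

  ≃-refl : ∀ {x} → x ≢ 0# → x ≃ x
  ≃-refl x≢0 = mk≃ x≢0 x≢0 (subst K (sym (inverseʳ _ x≢0)) K-one)

  ≡⇒≃ : ∀ {x y} → y ≢ 0# → x ≡ y → x ≃ y
  ≡⇒≃ y≢0 refl = ≃-refl y≢0

  ≃-sym : ∀ {x y} → x ≃ y → y ≃ x
  ≃-sym {x} {y} (mk≃ x≢0 y≢0 r) = mk≃ y≢0 x≢0 (subst K (begin
    (x * y ⁻¹) ⁻¹        ≡⟨ ⁻¹-distrib-* x≢0 (x⁻¹≢0 y≢0) ⟩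
    x ⁻¹ * y ⁻¹ ⁻¹       ≡⟨ cong (x ⁻¹ *_) (⁻¹-involutive y≢0) ⟩
    x ⁻¹ * y             ≡⟨ *-comm _ _ ⟩
    y * x ⁻¹             ∎) (K-inv r))

  ≃-trans : ∀ {x y z} → x ≃ y → y ≃ z → x ≃ z
  ≃-trans {x} {y} {z} (mk≃ x≢0 y≢0 r) (mk≃ _ z≢0 r′) = mk≃ x≢0 z≢0 (subst K (begin
    (x * y ⁻¹) * (y * z ⁻¹)  ≡⟨ solve 4 (λ x y′ y z′ → (x :* y′) :* (y :* z′) := (x :* z′) :* (y′ :* y)) refl x (y ⁻¹) y (z ⁻¹) ⟩
    (x * z ⁻¹) * (y ⁻¹ * y)  ≡⟨ cong ((x * z ⁻¹) *_) (inverseˡ y≢0) ⟩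
    (x * z ⁻¹) * 1#          ≡⟨ *-identityʳ _ ⟩
    x * z ⁻¹                 ∎) (K-mul r r′))

  ≃-partialSetoid : PartialSetoid 0ℓ 0ℓ
  ≃-partialSetoid = record { _≈_ = _≃_ ; isPartialEquivalence = record { sym = ≃-sym ; trans = ≃-trans } }

  module ≃-Reasoning = Relation.Binary.Reasoning.PartialSetoid ≃-partialSetoid

  ≃-* : ∀ {x x′ y y′} → x ≃ x′ → y ≃ y′ → x * y ≃ x′ * y′
  ≃-* {x} {x′} {y} {y′} (mk≃ x≢0 x′≢0 r) (mk≃ y≢0 y′≢0 r′) =
    mk≃ (x*y≢0 x≢0 y≢0) (x*y≢0 x′≢0 y′≢0) (subst K (begin
    (x * x′ ⁻¹) * (y * y′ ⁻¹)  ≡⟨ *-interchange x (x′ ⁻¹) y (y′ ⁻¹) ⟩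
    (x * y) * (x′ ⁻¹ * y′ ⁻¹)  ≡⟨ cong ((x * y) *_) (⁻¹-distrib-* x′≢0 y′≢0) ⟨
    (x * y) * (x′ * y′) ⁻¹     ∎) (K-mul r r′))

  ≃-*ˡ : ∀ {x y} z → z ≢ 0# → x ≃ y → z * x ≃ z * y
  ≃-*ˡ z z≢0 = ≃-* (≃-refl z≢0)

  ≃-*ʳ : ∀ {x y} z → z ≢ 0# → x ≃ y → x * z ≃ y * z
  ≃-*ʳ z z≢0 x≃y = ≃-* x≃y (≃-refl z≢0)

  ≃-cancelʳ : ∀ {x y} z → z ≢ 0# → x * z ≃ y * z → x ≃ y
  ≃-cancelʳ {x} {y} z z≢0 xz≃yz = subst₂ _≃_ (cancel x) (cancel y) (≃-*ʳ (z ⁻¹) (x⁻¹≢0 z≢0) xz≃yz)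
    where
    cancel : ∀ w → (w * z) * z ⁻¹ ≡ w
    cancel w = trans (*-assoc w z _) (trans (cong (w *_) (inverseʳ z z≢0)) (*-identityʳ w))

  ≃-cancelˡ : ∀ {x y} z → z ≢ 0# → z * x ≃ z * y → x ≃ y
  ≃-cancelˡ {x} {y} z z≢0 zx≃zy = ≃-cancelʳ z z≢0 (subst₂ _≃_ (*-comm z x) (*-comm z y) zx≃zy)

  κx≃x : ∀ {κ x} → K κ → x ≢ 0# → κ * x ≃ x
  κx≃x {κ} {x} κ∈K x≢0 = mk≃ (x*y≢0 (K-nonzero κ∈K) x≢0) x≢0 (subst K (begin
    κ                   ≡⟨ *-identityʳ κ ⟨
    κ * 1#              ≡⟨ cong (κ *_) (inverseʳ x x≢0) ⟨
    κ * (x * x ⁻¹)      ≡⟨ *-assoc _ _ _ ⟨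
    (κ * x) * x ⁻¹      ∎) κ∈K)

  1≤∣K∣ : 1 ≤ ∣K∣
  1≤∣K∣ = count-pos K? (elems-complete 1#) K-one

  ∣K∣<order : ∣K∣ < order
  ∣K∣<order = subst (∣K∣ <_) (trans (sym (count-split U? K? elems)) (count-all U? (λ _ → tt) elems))
    (subst (_< count (U? ∩? K?) elems ℕ.+ count (U? ∩? ∁? K?) elems) (count-≐ (U? ∩? K?) K? (proj₂ , (tt ,_)) elems)
      (ℕ.m<m+n _ (count-pos (U? ∩? ∁? K?) (elems-complete 0#) (tt , λ 0∈K → K-nonzero 0∈K refl))))

  coset-size : ∀ {b} → b ≢ 0# → count (_≃? b) elems ≡ ∣K∣
  coset-size {b} b≢0 = sym (count-≡-bijection K? (_≃? b) _≟_ _≟_ elems-unique elems-unique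
    (λ _ → elems-complete _) (λ _ → elems-complete _) (_* b) (_* b ⁻¹)
    (λ κ∈K → κx≃x κ∈K b≢0) ratio∈K
    (λ {κ} _ → trans (*-assoc κ b _) (trans (cong (κ *_) (inverseʳ b b≢0)) (*-identityʳ κ)))
    (λ {x} _ → trans (*-assoc x _ b) (trans (cong (x *_) (inverseˡ b≢0)) (*-identityʳ x))))

  -- If q is even then -1 = 1. Otherwise |K| = m is even, while x ↦ x⁻¹ is an involution of K
  -- whose fixed points are the square roots ±1 of 1 lying in K.
  even⇒-1∈K : (m : ℕ) → order ℕ.∸ 1 ≡ n ℕ.* m → 2 ∣ order ℕ.* m → K (- 1#)
  even⇒-1∈K m q-1≡nm 2∣qm with 2 ∣? order
  ... | yes 2∣q = subst K 1≡-1 K-one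
    where
    1≡-1 : 1# ≡ - 1#
    1≡-1 = begin
      1#                 ≡⟨ solve 1 (λ o → o := :- o :+ (o :+ o)) refl 1# ⟩
      - 1# + (1# + 1#)   ≡⟨ cong (- 1# +_) (even-order⇒1+1≡0 2∣q) ⟩
      - 1# + 0#          ≡⟨ +-identityʳ _ ⟩
      - 1#               ∎
      where open ≡-Reasoning
  ... | no 2∤q with K? (- 1#)
  ...   | yes -1∈K = -1∈K
  ...   | no -1∉K = contradiction (subst (2 ∣_) (sym ∣K∣≡m) 2∣m)
    (involution-count-odd K? _⁻¹ 1# K-inv (λ x∈K → ⁻¹-involutive (K-nonzero x∈K)) K-one 1⁻¹≡1 only-1-fixed)
    where
    2∣m : 2 ∣ m
    2∣m with euclidsLemma order m prime[2] 2∣qm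
    ... | inj₁ 2∣q = contradiction 2∣q 2∤q
    ... | inj₂ 2∣m = 2∣m
    n≢0 : n ≢ 0
    n≢0 refl = ℕ.<⇒≱ 2≤order (ℕ.m∸n≡0⇒m≤n (trans (sym K-index) (ℕ.*-zeroʳ ∣K∣)))
    ∣K∣≡m : ∣K∣ ≡ m
    ∣K∣≡m = ℕ.*-cancelʳ-≡ ∣K∣ m n {{ℕ.≢-nonZero n≢0}} (trans K-index (trans q-1≡nm (ℕ.*-comm n m)))
    only-1-fixed : ∀ {x} → K x → x ⁻¹ ≡ x → x ≡ 1#
    only-1-fixed {x} x∈K x⁻¹≡x with x*x≡1⇒x≡±1 (trans (cong (x *_) (sym x⁻¹≡x)) (inverseʳ x (K-nonzero x∈K)))
    ... | inj₁ x≡1 = x≡1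
    ... | inj₂ x≡-1 = contradiction (subst K x≡-1 x∈K) -1∉K

  multiples-≈Ω : ∀ {u μ ν} → NonZeroV u → μ ≢ 0# ⊎ ν ≢ 0# → (μ · u) ≈Ω (ν · u) ⇔ ν ≃ μ
  multiples-≈Ω {u} {μ} {ν} u≢0 μ≢0⊎ν≢0 = mk⇔ to from
    where
    to : (μ · u) ≈Ω (ν · u) → ν ≃ μ
    to μu≈νu with Any.satisfied μu≈νu
    ... | κ , κ∈K , νu≡κμu with ·-cancelʳ u≢0 (trans νu≡κμu (·-assoc κ μ u)) | μ ≟ 0#
    ...   | ν≡κμ | no μ≢0 = subst (_≃ μ) (sym ν≡κμ) (κx≃x κ∈K μ≢0)
    ...   | ν≡κμ | yes refl = contradiction μ≢0⊎ν≢0 λ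
      { (inj₁ μ≢0) → μ≢0 refl
      ; (inj₂ ν≢0) → ν≢0 (trans ν≡κμ (zeroʳ κ)) }
    from : ν ≃ μ → (μ · u) ≈Ω (ν · u)
    from (mk≃ _ μ≢0 νμ⁻¹∈K) = Any.map (λ { refl → νμ⁻¹∈K , sym (trans (·-assoc _ μ u) (cong (_· u) (begin
      (ν * μ ⁻¹) * μ   ≡⟨ *-assoc ν _ μ ⟩
      ν * (μ ⁻¹ * μ)   ≡⟨ cong (ν *_) (inverseˡ μ≢0) ⟩
      ν * 1#           ≡⟨ *-identityʳ ν ⟩
      ν                ∎))) }) (elems-complete (ν * μ ⁻¹))

  x⁻¹*y≃a⇒y≃a*x : ∀ {x y a} → x ≢ 0# → x ⁻¹ * y ≃ a → y ≃ a * x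
  x⁻¹*y≃a⇒y≃a*x {x} {y} x≢0 x⁻¹y≃a = subst (_≃ _) (trans (*-comm _ x) (x*[x⁻¹*y]≡y x≢0 y)) (≃-*ʳ x x≢0 x⁻¹y≃a)

  y≃a*x⇒x⁻¹*y≃a : ∀ {x y a} → x ≢ 0# → y ≃ a * x → x ⁻¹ * y ≃ a
  y≃a*x⇒x⁻¹*y≃a {x} {y} {a} x≢0 y≃ax =
    subst (_ ≃_) (trans (cong (x ⁻¹ *_) (*-comm a x)) (x⁻¹*[x*y]≡y x≢0 a)) (≃-*ˡ (x ⁻¹) (x⁻¹≢0 x≢0) y≃ax)

  -x≃x : K (- 1#) → ∀ {x} → x ≢ 0# → - x ≃ x
  -x≃x -1∈K {x} x≢0 = subst (_≃ x) (-1*x≈-x x) (κx≃x -1∈K x≢0)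

  ≃-respˡ⇔ : ∀ {x x′ y} → x ≃ x′ → x ≃ y ⇔ x′ ≃ y
  ≃-respˡ⇔ x≃x′ = mk⇔ (≃-trans (≃-sym x≃x′)) (≃-trans x≃x′)

  ≃-respʳ⇔ : ∀ {x y y′} → y ≃ y′ → x ≃ y ⇔ x ≃ y′
  ≃-respʳ⇔ y≃y′ = mk⇔ (λ x≃y → ≃-trans x≃y y≃y′) (λ x≃y′ → ≃-trans x≃y′ (≃-sym y≃y′))

  ≃-*ʳ⇔ : ∀ {x y} z → z ≢ 0# → x ≃ y ⇔ x * z ≃ y * z
  ≃-*ʳ⇔ z z≢0 = mk⇔ (≃-*ʳ z z≢0) (≃-cancelʳ z z≢0)

module PathCounts (𝔽 : FiniteField) {n : ℕ} (H : Tatra.Subgroup 𝔽 n) where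
  open FiniteField 𝔽
  open FieldProperties 𝔽
  open Tatra 𝔽
  open Subgroup H
  open WithK H
  open PlaneProperties 𝔽
  open CosetProperties 𝔽 H

  -- Conditions on the coordinates X = det(w,γ), Y = det(α,w) of w, where E = det(α,γ) ≠ 0,
  -- for (Kα,Kw) ∈ ρ, for (Kw,Kβ) ∈ τ when γ = β, and for (Kw,K(λα)) ∈ τ.
  fromαˣ : SRep → F → Pred F 0ℓ
  fromαˣ (rT , a) E X = E ⁻¹ * X ≃ a
  fromαˣ (sT , a) E X = ⊤

  fromαʸ : SRep → Pred F 0ℓ
  fromαʸ (rT , a) Y = Y ≡ 0#
  fromαʸ (sT , a) Y = Y ≃ a

  toβˣ : SRep → Pred F 0ℓ
  toβˣ (rT , b) X = X ≡ 0#
  toβˣ (sT , b) X = X ≃ b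

  toβʸ : SRep → F → Pred F 0ℓ
  toβʸ (rT , b) E Y = 1# ≃ b * (E ⁻¹ * Y)
  toβʸ (sT , b) E Y = ⊤

  toλαˣ : SRep → F → F → Pred F 0ℓ
  toλαˣ (rT , b) λ′ E X = λ′ ≃ b * (E ⁻¹ * X)
  toλαˣ (sT , b) λ′ E X = ⊤

  toλαʸ : SRep → F → Pred F 0ℓ
  toλαʸ (rT , b) λ′ Y = Y ≡ 0#
  toλαʸ (sT , b) λ′ Y = - (λ′ * Y) ≃ b

  fromαˣ? : ∀ ρ E → Decidable (fromαˣ ρ E)
  fromαˣ? (rT , a) E X = E ⁻¹ * X ≃? a
  fromαˣ? (sT , a) E = U?

  fromαʸ? : ∀ ρ → Decidable (fromαʸ ρ)
  fromαʸ? (rT , a) Y = Y ≟ 0#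
  fromαʸ? (sT , a) Y = Y ≃? a

  toβˣ? : ∀ τ → Decidable (toβˣ τ)
  toβˣ? (rT , b) X = X ≟ 0#
  toβˣ? (sT , b) X = X ≃? b

  toβʸ? : ∀ τ E → Decidable (toβʸ τ E)
  toβʸ? (rT , b) E Y = 1# ≃? b * (E ⁻¹ * Y)
  toβʸ? (sT , b) E = U?

  toλαˣ? : ∀ τ λ′ E → Decidable (toλαˣ τ λ′ E)
  toλαˣ? (rT , b) λ′ E X = λ′ ≃? b * (E ⁻¹ * X)
  toλαˣ? (sT , b) λ′ E = U?

  toλαʸ? : ∀ τ λ′ → Decidable (toλαʸ τ λ′)
  toλαʸ? (rT , b) λ′ Y = Y ≟ 0#
  toλαʸ? (sT , b) λ′ Y = - (λ′ * Y) ≃? b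

  s⇔≃ : ∀ {x a} → a ≢ 0# → (x ≢ 0# × x ~ a) ⇔ x ≃ a
  s⇔≃ a≢0 = mk⇔ (λ (_ , r) → ~⇒≃ a≢0 r) (λ x≃a → nonzeroˡ x≃a , ratio∈K x≃a)

  fromα⇔ : ∀ ρ → ValidS ρ → ∀ {α γ} → NonZeroV α → det α γ ≢ 0# →
    ∀ w → InRel ρ α w ⇔ (fromαˣ ρ (det α γ) (det w γ) × fromαʸ ρ (det α w))
  fromα⇔ (sT , a) a≢0 α≢0 E≢0 w = mk⇔ (λ s → tt , Equivalence.to (s⇔≃ a≢0) s) (λ (_ , Y≃a) → Equivalence.from (s⇔≃ a≢0) Y≃a)
  fromα⇔ (rT , a) a≢0 {α} {γ} α≢0 E≢0 w = mk⇔
    (λ (Y≡0 , aα≈w) → to (subst ((a · α) ≈Ω_) (w≡ Y≡0) aα≈w) , Y≡0)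
    (λ (E⁻¹X≃a , Y≡0) → Y≡0 , subst ((a · α) ≈Ω_) (sym (w≡ Y≡0)) (from E⁻¹X≃a))
    where
    open Equivalence (multiples-≈Ω α≢0 (inj₁ a≢0))
    w≡ : det α w ≡ 0# → w ≡ (det α γ ⁻¹ * det w γ) · α
    w≡ = det[u,w]≡0⇒w≡·u E≢0

  toβ⇔ : ∀ τ → ValidS τ → ∀ {α β} → NonZeroV β → det α β ≢ 0# →
    ∀ w → InRel τ w β ⇔ (toβˣ τ (det w β) × toβʸ τ (det α β) (det α w))
  toβ⇔ (sT , b) b≢0 β≢0 D≢0 w = mk⇔ (λ s → Equivalence.to (s⇔≃ b≢0) s , tt) (λ (X≃b , _) → Equivalence.from (s⇔≃ b≢0) X≃b)
  toβ⇔ (rT , b) b≢0 {α} {β} β≢0 D≢0 w = mk⇔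
    (λ (X≡0 , bw≈β) → X≡0 , to (subst₂ _≈Ω_ (bw≡ X≡0) (sym (·-identityˡ β)) bw≈β))
    (λ (X≡0 , 1≃μ) → X≡0 , subst₂ _≈Ω_ (sym (bw≡ X≡0)) (·-identityˡ β) (from 1≃μ))
    where
    open Equivalence (multiples-≈Ω β≢0 (inj₂ 1≢0))
    bw≡ : det w β ≡ 0# → b · w ≡ (b * (det α β ⁻¹ * det α w)) · β
    bw≡ X≡0 = trans (cong (b ·_) (det[w,γ]≡0⇒w≡·γ D≢0 X≡0)) (·-assoc b _ β)

  toλα⇔ : ∀ τ → ValidS τ → ∀ {α γ λ′} → NonZeroV α → λ′ ≢ 0# → det α γ ≢ 0# →
    ∀ w → InRel τ w (λ′ · α) ⇔ (toλαˣ τ λ′ (det α γ) (det w γ) × toλαʸ τ λ′ (det α w))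
  toλα⇔ (sT , b) b≢0 {α} {γ} {λ′} α≢0 λ′≢0 E≢0 w = mk⇔
    (λ s → tt , subst (_≃ b) (det-·ʳ w λ′ α) (Equivalence.to (s⇔≃ b≢0) s))
    (λ (_ , -λ′Y≃b) → Equivalence.from (s⇔≃ b≢0) (subst (_≃ b) (sym (det-·ʳ w λ′ α)) -λ′Y≃b))
  toλα⇔ (rT , b) b≢0 {α} {γ} {λ′} α≢0 λ′≢0 E≢0 w = mk⇔
    (λ (d≡0 , bw≈λα) → let Y≡0 = ⇒Y≡0 d≡0 in to (subst (_≈Ω (λ′ · α)) (bw≡ Y≡0) bw≈λα) , Y≡0)
    (λ (λ′≃μ , Y≡0) → Y≡0⇒ Y≡0 , subst (_≈Ω (λ′ · α)) (sym (bw≡ Y≡0)) (from λ′≃μ))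
    where
    open Equivalence (multiples-≈Ω α≢0 (inj₂ λ′≢0))
    bw≡ : det α w ≡ 0# → b · w ≡ (b * (det α γ ⁻¹ * det w γ)) · α
    bw≡ Y≡0 = trans (cong (b ·_) (det[u,w]≡0⇒w≡·u E≢0 Y≡0)) (·-assoc b _ α)
    Y≡0⇒ : det α w ≡ 0# → det w (λ′ · α) ≡ 0#
    Y≡0⇒ Y≡0 = trans (det-·ʳ w λ′ α) (trans (cong (λ y → - (λ′ * y)) Y≡0) (trans (cong -_ (zeroʳ λ′)) -0#≈0#))
    ⇒Y≡0 : det w (λ′ · α) ≡ 0# → det α w ≡ 0#
    ⇒Y≡0 d≡0 = *-cancelˡ λ′≢0 (trans (-x≡0⇒x≡0 (trans (sym (det-·ʳ w λ′ α)) d≡0)) (sym (zeroʳ λ′)))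

  InRel⇒nonzero : ∀ ρ → ValidS ρ → ∀ {α w} → NonZeroV α → InRel ρ α w → NonZeroV w
  InRel⇒nonzero (sT , a) _ _ (det≢0 , _) = det≢0⇒nonzeroʳ det≢0
  InRel⇒nonzero (rT , a) a≢0 α≢0 (_ , aα≈w) with Any.satisfied aα≈w
  ... | κ , κ∈K , w≡κaα = subst NonZeroV (sym w≡κaα) (·-nonzero (K-nonzero κ∈K) (·-nonzero a≢0 α≢0))

  pathCount-transversal : ∀ ρ τ → ValidS ρ → ValidS τ → ∀ {α β} → NonZeroV α → NonZeroV β → det α β ≢ 0# →
    pathCount ρ τ α β ≡
      count (fromαˣ? ρ (det α β) ∩? toβˣ? τ) elems ℕ.* count (fromαʸ? ρ ∩? toβʸ? τ (det α β)) elems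
  pathCount-transversal ρ τ ρ-valid τ-valid α≢0 β≢0 D≢0 = count-by-coordinates D≢0 _ _ _
    (λ w → ×-⇔-interchange (fromα⇔ ρ ρ-valid α≢0 D≢0 w) (toβ⇔ τ τ-valid β≢0 D≢0 w))
    (λ (αw∈ρ , _) → InRel⇒nonzero ρ ρ-valid α≢0 αw∈ρ)

  pathCount-collinear : ∀ ρ τ → ValidS ρ → ValidS τ → ∀ {α γ λ′} → NonZeroV α → λ′ ≢ 0# → det α γ ≢ 0# →
    pathCount ρ τ α (λ′ · α) ≡
      count (fromαˣ? ρ (det α γ) ∩? toλαˣ? τ λ′ (det α γ)) elems ℕ.* count (fromαʸ? ρ ∩? toλαʸ? τ λ′) elems
  pathCount-collinear ρ τ ρ-valid τ-valid α≢0 λ′≢0 E≢0 = count-by-coordinates E≢0 _ _ _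
    (λ w → ×-⇔-interchange (fromα⇔ ρ ρ-valid α≢0 E≢0 w) (toλα⇔ τ τ-valid α≢0 λ′≢0 E≢0 w))
    (λ (αw∈ρ , _) → InRel⇒nonzero ρ ρ-valid α≢0 αw∈ρ)

  count-coset : ∀ {P : Pred F 0ℓ} (P? : Decidable P) {b} → b ≢ 0# → P ≐ (_≃ b) → count P? elems ≡ ∣K∣
  count-coset P? {b} b≢0 P≐ = trans (count-≐ P? (_≃? b) P≐ elems) (coset-size b≢0)

  count-coset-when : ∀ {P : Pred F 0ℓ} (P? : Decidable P) {C : Set} (C? : Dec C) {b} → b ≢ 0# →
    (∀ {X} → P X → C × X ≃ b) → (C → ∀ {X} → X ≃ b → P X) → count P? elems ≡ when C? ∣K∣
  count-coset-when P? (yes c) b≢0 P⇒ ⇒P = count-coset P? b≢0 ((λ p → proj₂ (P⇒ p)) , ⇒P c)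
  count-coset-when P? (no ¬c) _ P⇒ _ = count-empty P? (λ _ p → ¬c (proj₁ (P⇒ p))) elems

  count-zero : ∀ {P : Pred F 0ℓ} (P? : Decidable P) → P ≐ (_≡ 0#) → count P? elems ≡ 1
  count-zero P? P≐ = trans (count-≐ P? (_≟ 0#) P≐ elems) (count-≟ _≟_ elems-unique (elems-complete 0#))

  -- kc ρ τ t = |K| · c_{ρτ}^t
  kc : SRep → SRep → SRep → ℕ
  kc (rT , a) (rT , b) (rT , c) = when (c ≃? a * b) ∣K∣
  kc (rT , a) (sT , b) (rT , c) = 0
  kc (sT , a) (rT , b) (rT , c) = 0
  kc (sT , a) (sT , b) (rT , c) = when (c * a ≃? b) (order ℕ.* ∣K∣)
  kc (rT , a) (rT , b) (sT , c) = 0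
  kc (rT , a) (sT , b) (sT , c) = when (a * c ≃? b) ∣K∣
  kc (sT , a) (rT , b) (sT , c) = when (c ≃? a * b) ∣K∣
  kc (sT , a) (sT , b) (sT , c) = ∣K∣ ℕ.* ∣K∣

  pathCount≡kc-s : ∀ ρ τ → ValidS ρ → ValidS τ → ∀ {c α β} → NonZeroV α → NonZeroV β → det α β ≃ c →
    pathCount ρ τ α β ≡ kc ρ τ (sT , c)
  pathCount≡kc-s (sT , a) (sT , b) a≢0 b≢0 α≢0 β≢0 D≃c =
    trans (pathCount-transversal (sT , a) (sT , b) a≢0 b≢0 α≢0 β≢0 (nonzeroˡ D≃c))
      (cong₂ ℕ._*_ (count-coset _ b≢0 (proj₂ , (tt ,_))) (count-coset _ a≢0 (proj₁ , (_, tt))))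
  pathCount≡kc-s (rT , a) (sT , b) a≢0 b≢0 {c} {α} {β} α≢0 β≢0 D≃c =
    trans (pathCount-transversal (rT , a) (sT , b) a≢0 b≢0 α≢0 β≢0 D≢0)
      (trans (cong₂ ℕ._*_ (count-coset-when _ (a * c ≃? b) b≢0 P⇒ ⇒P) (count-zero _ (proj₁ , (_, tt))))
        (ℕ.*-identityʳ _))
    where
    D : F
    D = det α β
    D≢0 : D ≢ 0#
    D≢0 = nonzeroˡ D≃c
    P⇒ : ∀ {X} → D ⁻¹ * X ≃ a × X ≃ b → a * c ≃ b × X ≃ b
    P⇒ {X} (D⁻¹X≃a , X≃b) = (begin
      a * c        ≈⟨ ≃-*ˡ a a≢0 D≃c ⟨
      a * D        ≈⟨ x⁻¹*y≃a⇒y≃a*x D≢0 D⁻¹X≃a ⟨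
      X            ≈⟨ X≃b ⟩
      b            ∎) , X≃b
      where open ≃-Reasoning
    ⇒P : a * c ≃ b → ∀ {X} → X ≃ b → D ⁻¹ * X ≃ a × X ≃ b
    ⇒P ac≃b {X} X≃b = y≃a*x⇒x⁻¹*y≃a D≢0 (begin
      X            ≈⟨ X≃b ⟩
      b            ≈⟨ ac≃b ⟨
      a * c        ≈⟨ ≃-*ˡ a a≢0 D≃c ⟨
      a * D        ∎) , X≃b
      where open ≃-Reasoning
  pathCount≡kc-s (sT , a) (rT , b) a≢0 b≢0 {c} {α} {β} α≢0 β≢0 D≃c =
    trans (pathCount-transversal (sT , a) (rT , b) a≢0 b≢0 α≢0 β≢0 D≢0)
      (trans (cong₂ ℕ._*_ (count-zero _ (proj₂ , (tt ,_))) (count-coset-when _ (c ≃? a * b) a≢0 P⇒ ⇒P))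
        (ℕ.*-identityˡ _))
    where
    D : F
    D = det α β
    D≢0 : D ≢ 0#
    D≢0 = nonzeroˡ D≃c
    reorder : ∀ Y → b * (D ⁻¹ * Y) ≡ D ⁻¹ * (b * Y)
    reorder Y = solve 3 (λ b d y → b :* (d :* y) := d :* (b :* y)) refl b (D ⁻¹) Y
    P⇒ : ∀ {Y} → Y ≃ a × 1# ≃ b * (D ⁻¹ * Y) → c ≃ a * b × Y ≃ a
    P⇒ {Y} (Y≃a , 1≃bD⁻¹Y) = (begin
      c            ≈⟨ D≃c ⟨
      D            ≡⟨ *-identityˡ D ⟨
      1# * D       ≈⟨ x⁻¹*y≃a⇒y≃a*x D≢0 (subst (_≃ 1#) (reorder Y) (≃-sym 1≃bD⁻¹Y)) ⟨
      b * Y        ≈⟨ ≃-*ˡ b b≢0 Y≃a ⟩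
      b * a        ≡⟨ *-comm b a ⟩
      a * b        ∎) , Y≃a
      where open ≃-Reasoning
    ⇒P : c ≃ a * b → ∀ {Y} → Y ≃ a → Y ≃ a × 1# ≃ b * (D ⁻¹ * Y)
    ⇒P c≃ab {Y} Y≃a = Y≃a , ≃-sym (subst (_≃ 1#) (sym (reorder Y)) (y≃a*x⇒x⁻¹*y≃a D≢0 (begin
      b * Y        ≈⟨ ≃-*ˡ b b≢0 Y≃a ⟩
      b * a        ≡⟨ *-comm b a ⟩
      a * b        ≈⟨ c≃ab ⟨
      c            ≈⟨ D≃c ⟨
      D            ≡⟨ *-identityˡ D ⟨
      1# * D       ∎)))
      where open ≃-Reasoning
  pathCount≡kc-s (rT , a) (rT , b) a≢0 b≢0 {α = α} {β} α≢0 β≢0 D≃c =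
    trans (pathCount-transversal (rT , a) (rT , b) a≢0 b≢0 α≢0 β≢0 (nonzeroˡ D≃c))
      (cong (ℕ._* count (fromαʸ? (rT , a) ∩? toβʸ? (rT , b) (det α β)) elems)
        (count-empty _ (λ { _ (D⁻¹X≃a , refl) → nonzeroˡ D⁻¹X≃a (zeroʳ _) }) elems))

  pathCount≡kc-r : K (- 1#) → ∀ ρ τ → ValidS ρ → ValidS τ → ∀ {c λ′ α γ} → NonZeroV α → det α γ ≢ 0# → λ′ ≃ c →
    pathCount ρ τ α (λ′ · α) ≡ kc ρ τ (rT , c)
  pathCount≡kc-r -1∈K (sT , a) (sT , b) a≢0 b≢0 {c} {λ′} α≢0 E≢0 λ′≃c =
    trans (pathCount-collinear (sT , a) (sT , b) a≢0 b≢0 α≢0 (nonzeroˡ λ′≃c) E≢0)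
      (trans (cong₂ ℕ._*_ (count-all _ (λ _ → tt , tt) elems) (count-coset-when _ (c * a ≃? b) a≢0 P⇒ ⇒P))
        (*-when order (c * a ≃? b) ∣K∣))
    where
    -λ′Y≃λ′Y : ∀ {Y} → Y ≃ a → - (λ′ * Y) ≃ λ′ * Y
    -λ′Y≃λ′Y Y≃a = -x≃x -1∈K (x*y≢0 (nonzeroˡ λ′≃c) (nonzeroˡ Y≃a))
    P⇒ : ∀ {Y} → Y ≃ a × - (λ′ * Y) ≃ b → c * a ≃ b × Y ≃ a
    P⇒ {Y} (Y≃a , -λ′Y≃b) = (begin
      c * a          ≈⟨ ≃-* λ′≃c Y≃a ⟨
      λ′ * Y         ≈⟨ -λ′Y≃λ′Y Y≃a ⟨
      - (λ′ * Y)     ≈⟨ -λ′Y≃b ⟩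
      b              ∎) , Y≃a
      where open ≃-Reasoning
    ⇒P : c * a ≃ b → ∀ {Y} → Y ≃ a → Y ≃ a × - (λ′ * Y) ≃ b
    ⇒P ca≃b {Y} Y≃a = Y≃a , (begin
      - (λ′ * Y)     ≈⟨ -λ′Y≃λ′Y Y≃a ⟩
      λ′ * Y         ≈⟨ ≃-* λ′≃c Y≃a ⟩
      c * a          ≈⟨ ca≃b ⟩
      b              ∎)
      where open ≃-Reasoning
  pathCount≡kc-r -1∈K (rT , a) (sT , b) a≢0 b≢0 {λ′ = λ′} {α} {γ} α≢0 E≢0 λ′≃c =
    trans (pathCount-collinear (rT , a) (sT , b) a≢0 b≢0 α≢0 (nonzeroˡ λ′≃c) E≢0)
      (trans (cong (Xs ℕ.*_) (count-empty _ (λ { _ (refl , -λ′0≃b) → nonzeroˡ -λ′0≃b -λ′0≡0 }) elems))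
        (ℕ.*-zeroʳ Xs))
    where
    Xs : ℕ
    Xs = count (fromαˣ? (rT , a) (det α γ) ∩? toλαˣ? (sT , b) λ′ (det α γ)) elems
    -λ′0≡0 : - (λ′ * 0#) ≡ 0#
    -λ′0≡0 = trans (cong -_ (zeroʳ λ′)) -0#≈0#
  pathCount≡kc-r -1∈K (sT , a) (rT , b) a≢0 b≢0 {λ′ = λ′} {α} {γ} α≢0 E≢0 λ′≃c =
    trans (pathCount-collinear (sT , a) (rT , b) a≢0 b≢0 α≢0 (nonzeroˡ λ′≃c) E≢0)
      (trans (cong (Xs ℕ.*_) (count-empty _ (λ { _ (Y≃a , refl) → nonzeroˡ Y≃a refl }) elems))
        (ℕ.*-zeroʳ Xs))
    where
    Xs : ℕ
    Xs = count (fromαˣ? (sT , a) (det α γ) ∩? toλαˣ? (rT , b) λ′ (det α γ)) elems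
  pathCount≡kc-r -1∈K (rT , a) (rT , b) a≢0 b≢0 {c} {λ′} {α} {γ} α≢0 E≢0 λ′≃c =
    trans (pathCount-collinear (rT , a) (rT , b) a≢0 b≢0 α≢0 (nonzeroˡ λ′≃c) E≢0)
      (trans (cong₂ ℕ._*_ (count-coset-when _ (c ≃? a * b) (x*y≢0 a≢0 E≢0) P⇒ ⇒P)
                          (count-zero _ (proj₁ , λ Y≡0 → Y≡0 , Y≡0)))
        (ℕ.*-identityʳ _))
    where
    E : F
    E = det α γ
    P⇒ : ∀ {X} → E ⁻¹ * X ≃ a × λ′ ≃ b * (E ⁻¹ * X) → c ≃ a * b × X ≃ a * E
    P⇒ {X} (E⁻¹X≃a , λ′≃bE⁻¹X) = (begin
      c              ≈⟨ λ′≃c ⟨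
      λ′             ≈⟨ λ′≃bE⁻¹X ⟩
      b * (E ⁻¹ * X) ≈⟨ ≃-*ˡ b b≢0 E⁻¹X≃a ⟩
      b * a          ≡⟨ *-comm b a ⟩
      a * b          ∎) , x⁻¹*y≃a⇒y≃a*x E≢0 E⁻¹X≃a
      where open ≃-Reasoning
    ⇒P : c ≃ a * b → ∀ {X} → X ≃ a * E → E ⁻¹ * X ≃ a × λ′ ≃ b * (E ⁻¹ * X)
    ⇒P c≃ab {X} X≃aE = E⁻¹X≃a , (begin
      λ′             ≈⟨ λ′≃c ⟩
      c              ≈⟨ c≃ab ⟩
      a * b          ≡⟨ *-comm a b ⟩
      b * a          ≈⟨ ≃-*ˡ b b≢0 E⁻¹X≃a ⟨
      b * (E ⁻¹ * X) ∎)
      where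
      open ≃-Reasoning
      E⁻¹X≃a : E ⁻¹ * X ≃ a
      E⁻¹X≃a = y≃a*x⇒x⁻¹*y≃a E≢0 X≃aE

  pathCount≡kc : K (- 1#) → ∀ ρ τ t → ValidS ρ → ValidS τ → ValidS t → ∀ {α β} → NonZeroV α → NonZeroV β →
    InRel t α β → pathCount ρ τ α β ≡ kc ρ τ t
  pathCount≡kc -1∈K ρ τ (sT , c) ρ-valid τ-valid c≢0 α≢0 β≢0 (_ , D~c) =
    pathCount≡kc-s ρ τ ρ-valid τ-valid α≢0 β≢0 (~⇒≃ c≢0 D~c)
  pathCount≡kc -1∈K ρ τ (rT , c) ρ-valid τ-valid c≢0 {α} α≢0 β≢0 (_ , cα≈β)
    with Any.satisfied cα≈β | complement α≢0
  ... | κ , κ∈K , β≡κ[cα] | γ , E≢0 = trans (cong (pathCount ρ τ α) (trans β≡κ[cα] (·-assoc κ c α)))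
    (pathCount≡kc-r -1∈K ρ τ ρ-valid τ-valid α≢0 E≢0 (κx≃x κ∈K c≢0))

module Automorphisms (𝔽 : FiniteField) {n : ℕ} (H : Tatra.Subgroup 𝔽 n) where
  open FiniteField 𝔽
  open FieldProperties 𝔽
  open Tatra 𝔽
  open Subgroup H
  open WithK H
  open PlaneProperties 𝔽
  open CosetProperties 𝔽 H
  open PathCounts 𝔽 H

  private instance
    ∣K∣-nonZero : ℕ.NonZero ∣K∣
    ∣K∣-nonZero = ℕ.>-nonZero 1≤∣K∣

  private
    below-q∣K∣ : ∀ {m} → m ≤ ∣K∣ → m ≢ order ℕ.* ∣K∣
    below-q∣K∣ m≤∣K∣ = ℕ.<⇒≢ (ℕ.≤-<-trans m≤∣K∣ (subst (∣K∣ <_) (ℕ.*-comm ∣K∣ order) (ℕ.m<m*n ∣K∣ order 2≤order)))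

  -- Every other entry is at most |K|² < q·|K|.
  kc≡q∣K∣⇒s,s,r : ∀ ρ τ t → kc ρ τ t ≡ order ℕ.* ∣K∣ → proj₁ ρ ≡ sT × proj₁ τ ≡ sT × proj₁ t ≡ rT
  kc≡q∣K∣⇒s,s,r (sT , a) (sT , b) (rT , c) _ = refl , refl , refl
  kc≡q∣K∣⇒s,s,r (rT , a) (rT , b) (rT , c) eq = contradiction eq (below-q∣K∣ (when-≤ (c ≃? a * b) ∣K∣))
  kc≡q∣K∣⇒s,s,r (rT , a) (sT , b) (rT , c) eq = contradiction eq (below-q∣K∣ z≤n)
  kc≡q∣K∣⇒s,s,r (sT , a) (rT , b) (rT , c) eq = contradiction eq (below-q∣K∣ z≤n)
  kc≡q∣K∣⇒s,s,r (rT , a) (rT , b) (sT , c) eq = contradiction eq (below-q∣K∣ z≤n)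
  kc≡q∣K∣⇒s,s,r (rT , a) (sT , b) (sT , c) eq = contradiction eq (below-q∣K∣ (when-≤ (a * c ≃? b) ∣K∣))
  kc≡q∣K∣⇒s,s,r (sT , a) (rT , b) (sT , c) eq = contradiction eq (below-q∣K∣ (when-≤ (c ≃? a * b) ∣K∣))
  kc≡q∣K∣⇒s,s,r (sT , a) (sT , b) (sT , c) eq = contradiction eq (ℕ.<⇒≢ (ℕ.*-monoˡ-< ∣K∣ ∣K∣<order))

  Arc : SRep → Set
  Arc t = Σ V λ α → Σ V λ β → NonZeroV α × NonZeroV β × InRel t α β

  private
    e₁ : V
    e₁ = 1# , 0#

    e₁≢0 : NonZeroV e₁
    e₁≢0 (1≡0 , _) = 1≢0 1≡0

  relation-nonempty : ∀ t → ValidS t → Arc t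
  relation-nonempty (rT , c) c≢0 = e₁ , c · e₁ , e₁≢0 , ·-nonzero c≢0 e₁≢0 , det≡0 , ce₁≈ce₁
    where
    det≡0 : det e₁ (c · e₁) ≡ 0#
    det≡0 = trans (cong₂ (λ x y → 1# * x + - y) (zeroʳ c) (zeroˡ _)) (trans (cong₂ _+_ (zeroʳ 1#) -0#≈0#) (+-identityˡ 0#))
    ce₁≈ce₁ : (c · e₁) ≈Ω (c · e₁)
    ce₁≈ce₁ = Any.map (λ { refl → K-one , sym (·-identityˡ (c · e₁)) }) (elems-complete 1#)
  relation-nonempty (sT , c) c≢0 =
    e₁ , (0# , c) , e₁≢0 , (λ (_ , c≡0) → c≢0 c≡0) ,
    (λ det≡0 → c≢0 (trans (sym det≡c) det≡0)) , ratio∈K (≡⇒≃ c≢0 det≡c)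
    where
    det≡c : det e₁ (0# , c) ≡ c
    det≡c = trans (cong₂ (λ x y → x + - y) (*-identityˡ c) (zeroˡ 0#)) (trans (cong (c +_) -0#≈0#) (+-identityʳ c))

  KcInvariant : (SRep → SRep) → Set
  KcInvariant φ = ∀ ρ τ t → ValidS ρ → ValidS τ → ValidS t → kc ρ τ t ≡ kc (φ ρ) (φ τ) (φ t)

  module _ {σ : F → F} (σ-aut : IsAutC σ) {g : F} (g≢0 : g ≢ 0#) where
    open IsAutC σ-aut renaming (valid to σ-valid; resp to σ-resp; hom to σ-hom; inj to σ-inj; surj to σ-surj)

    σ-≃ : ∀ {x y} → x ≃ y → σ x ≃ σ y
    σ-≃ (mk≃ x≢0 y≢0 x~y) = ~⇒≃ (σ-valid _ y≢0) (σ-resp _ _ x≢0 y≢0 x~y)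

    σ-≃⇔ : ∀ {x y} → x ≢ 0# → y ≢ 0# → x ≃ y ⇔ σ x ≃ σ y
    σ-≃⇔ x≢0 y≢0 = mk⇔ σ-≃ (λ σx≃σy → ~⇒≃ y≢0 (σ-inj _ _ x≢0 y≢0 (ratio∈K σx≃σy)))

    σ-* : ∀ {x y} → x ≢ 0# → y ≢ 0# → σ (x * y) ≃ σ x * σ y
    σ-* x≢0 y≢0 = ~⇒≃ (x*y≢0 (σ-valid _ x≢0) (σ-valid _ y≢0)) (σ-hom _ _ x≢0 y≢0)

    φ[σ,g]-perm : IsPermS φ[ σ , g ]
    φ[σ,g]-perm = record { valid = φ-valid ; resp = φ-resp ; inj = φ-inj ; surj = φ-surj }
      where
      φ-valid : ∀ t → ValidS t → ValidS (φ[ σ , g ] t)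
      φ-valid (rT , x) x≢0 = σ-valid x x≢0
      φ-valid (sT , x) x≢0 = x*y≢0 (σ-valid x x≢0) g≢0
      φ-resp : ∀ t t′ → ValidS t → ValidS t′ → t ≈S t′ → φ[ σ , g ] t ≈S φ[ σ , g ] t′
      φ-resp (rT , x) (rT , y) x≢0 y≢0 (refl , x~y) = refl , σ-resp x y x≢0 y≢0 x~y
      φ-resp (sT , x) (sT , y) x≢0 y≢0 (refl , x~y) = refl , ratio∈K (≃-*ʳ g g≢0 (σ-≃ (~⇒≃ y≢0 x~y)))
      φ-inj : ∀ t t′ → ValidS t → ValidS t′ → φ[ σ , g ] t ≈S φ[ σ , g ] t′ → t ≈S t′
      φ-inj (rT , x) (rT , y) x≢0 y≢0 (refl , σx~σy) = refl , σ-inj x y x≢0 y≢0 σx~σy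
      φ-inj (sT , x) (sT , y) x≢0 y≢0 (refl , σxg~σyg) =
        refl , ratio∈K (Equivalence.from (σ-≃⇔ x≢0 y≢0) (≃-cancelʳ g g≢0 (~⇒≃ (x*y≢0 (σ-valid y y≢0) g≢0) σxg~σyg)))
      φ-surj : ∀ t′ → ValidS t′ → Σ SRep (λ t → ValidS t × φ[ σ , g ] t ≈S t′)
      φ-surj (rT , y) y≢0 with σ-surj y y≢0
      ... | x , x≢0 , σx~y = (rT , x) , x≢0 , refl , σx~y
      φ-surj (sT , y) y≢0 with σ-surj (y * g ⁻¹) (x*y≢0 y≢0 (x⁻¹≢0 g≢0))
      ... | x , x≢0 , σx~yg⁻¹ = (sT , x) , x≢0 , refl , ratio∈K (subst (σ x * g ≃_) yg⁻¹g≡y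
            (≃-*ʳ g g≢0 (~⇒≃ (x*y≢0 y≢0 (x⁻¹≢0 g≢0)) σx~yg⁻¹)))
        where
        yg⁻¹g≡y : (y * g ⁻¹) * g ≡ y
        yg⁻¹g≡y = trans (*-assoc y _ g) (trans (cong (y *_) (inverseˡ g≢0)) (*-identityʳ y))

    φ[σ,g]-invariant : KcInvariant φ[ σ , g ]
    φ[σ,g]-invariant (rT , a) (rT , b) (rT , c) a≢0 b≢0 c≢0 = when-cong _ _ (begin
      c ≃ a * b                    ≈⟨ σ-≃⇔ c≢0 (x*y≢0 a≢0 b≢0) ⟩
      σ c ≃ σ (a * b)              ≈⟨ ≃-respʳ⇔ (σ-* a≢0 b≢0) ⟩
      σ c ≃ σ a * σ b              ∎) ∣K∣
      where open SetoidReasoning (⇔-setoid 0ℓ)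
    φ[σ,g]-invariant (rT , a) (sT , b) (rT , c) _ _ _ = refl
    φ[σ,g]-invariant (sT , a) (rT , b) (rT , c) _ _ _ = refl
    φ[σ,g]-invariant (sT , a) (sT , b) (rT , c) a≢0 b≢0 c≢0 = when-cong _ _ (begin
      c * a ≃ b                    ≈⟨ σ-≃⇔ (x*y≢0 c≢0 a≢0) b≢0 ⟩
      σ (c * a) ≃ σ b              ≈⟨ ≃-respˡ⇔ (σ-* c≢0 a≢0) ⟩
      σ c * σ a ≃ σ b              ≈⟨ ≃-*ʳ⇔ g g≢0 ⟩
      (σ c * σ a) * g ≃ σ b * g    ≡⟨ cong (_≃ σ b * g) (*-assoc (σ c) (σ a) g) ⟩
      σ c * (σ a * g) ≃ σ b * g    ∎) (order ℕ.* ∣K∣)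
      where open SetoidReasoning (⇔-setoid 0ℓ)
    φ[σ,g]-invariant (rT , a) (rT , b) (sT , c) _ _ _ = refl
    φ[σ,g]-invariant (rT , a) (sT , b) (sT , c) a≢0 b≢0 c≢0 = when-cong _ _ (begin
      a * c ≃ b                    ≈⟨ σ-≃⇔ (x*y≢0 a≢0 c≢0) b≢0 ⟩
      σ (a * c) ≃ σ b              ≈⟨ ≃-respˡ⇔ (σ-* a≢0 c≢0) ⟩
      σ a * σ c ≃ σ b              ≈⟨ ≃-*ʳ⇔ g g≢0 ⟩
      (σ a * σ c) * g ≃ σ b * g    ≡⟨ cong (_≃ σ b * g) (*-assoc (σ a) (σ c) g) ⟩
      σ a * (σ c * g) ≃ σ b * g    ∎) ∣K∣
      where open SetoidReasoning (⇔-setoid 0ℓ)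
    φ[σ,g]-invariant (sT , a) (rT , b) (sT , c) a≢0 b≢0 c≢0 = when-cong _ _ (begin
      c ≃ a * b                    ≈⟨ σ-≃⇔ c≢0 (x*y≢0 a≢0 b≢0) ⟩
      σ c ≃ σ (a * b)              ≈⟨ ≃-respʳ⇔ (σ-* a≢0 b≢0) ⟩
      σ c ≃ σ a * σ b              ≈⟨ ≃-*ʳ⇔ g g≢0 ⟩
      σ c * g ≃ (σ a * σ b) * g    ≡⟨ cong (σ c * g ≃_) (solve 3 (λ x y z → (x :* y) :* z := (x :* z) :* y) refl (σ a) (σ b) g) ⟩
      σ c * g ≃ (σ a * g) * σ b    ∎) ∣K∣
      where open SetoidReasoning (⇔-setoid 0ℓ)
    φ[σ,g]-invariant (sT , a) (sT , b) (sT , c) _ _ _ = refl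

  φ[,]-injective : (σ τ : F → F) (g h : F) → IsAutC σ → IsAutC τ → g ≢ 0# → h ≢ 0# →
    (∀ t → ValidS t → φ[ σ , g ] t ≈S φ[ τ , h ] t) → (∀ x → x ≢ 0# → σ x ~ τ x) × g ~ h
  φ[,]-injective σ τ g h σ-aut τ-aut g≢0 h≢0 φσg≈φτh = (λ x x≢0 → proj₂ (φσg≈φτh (rT , x) x≢0)) , ratio∈K g≃h
    where
    σ1≢0 : σ 1# ≢ 0#
    σ1≢0 = IsAutC.valid σ-aut 1# 1≢0
    τ1≢0 : τ 1# ≢ 0#
    τ1≢0 = IsAutC.valid τ-aut 1# 1≢0
    σ1≃τ1 : σ 1# ≃ τ 1#
    σ1≃τ1 = ~⇒≃ τ1≢0 (proj₂ (φσg≈φτh (rT , 1#) 1≢0))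
    g≃h : g ≃ h
    g≃h = ≃-cancelˡ (σ 1#) σ1≢0 (begin
      σ 1# * g     ≈⟨ ~⇒≃ (x*y≢0 τ1≢0 h≢0) (proj₂ (φσg≈φτh (sT , 1#) 1≢0)) ⟩
      τ 1# * h     ≈⟨ ≃-*ʳ h h≢0 σ1≃τ1 ⟨
      σ 1# * h     ∎)
      where open ≃-Reasoning

  module _ (-1∈K : K (- 1#)) where

    IsAlgAut⇒KcInvariant : ∀ {φ} → IsAlgAut φ → KcInvariant φ
    IsAlgAut⇒KcInvariant {φ} φ-alg ρ τ t ρ-valid τ-valid t-valid =
      compare (relation-nonempty t t-valid) (relation-nonempty (φ t) (valid t t-valid))
      where
      open IsAlgAut φ-alg
      open IsPermS perm
      open ≡-Reasoning
      compare : Arc t → Arc (φ t) → kc ρ τ t ≡ kc (φ ρ) (φ τ) (φ t)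
      compare (α , β , α≢0 , β≢0 , αβ∈t) (α′ , β′ , α′≢0 , β′≢0 , α′β′∈φt) = begin
        kc ρ τ t                      ≡⟨ pathCount≡kc -1∈K ρ τ t ρ-valid τ-valid t-valid α≢0 β≢0 αβ∈t ⟨
        pathCount ρ τ α β             ≡⟨ intNo ρ τ t ρ-valid τ-valid t-valid α β α′ β′ α≢0 β≢0 α′≢0 β′≢0 αβ∈t α′β′∈φt ⟩
        pathCount (φ ρ) (φ τ) α′ β′   ≡⟨ pathCount≡kc -1∈K (φ ρ) (φ τ) (φ t) (valid ρ ρ-valid) (valid τ τ-valid) (valid t t-valid)
                                           α′≢0 β′≢0 α′β′∈φt ⟩
        kc (φ ρ) (φ τ) (φ t)          ∎

    KcInvariant⇒IsAlgAut : ∀ {φ} → IsPermS φ → KcInvariant φ → IsAlgAut φ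
    KcInvariant⇒IsAlgAut {φ} φ-perm φ-invariant = record { perm = φ-perm ; intNo = intNo }
      where
      open IsPermS φ-perm
      open ≡-Reasoning
      intNo : ∀ ρ τ t → ValidS ρ → ValidS τ → ValidS t →
        ∀ α β α′ β′ → NonZeroV α → NonZeroV β → NonZeroV α′ → NonZeroV β′ →
        InRel t α β → InRel (φ t) α′ β′ → pathCount ρ τ α β ≡ pathCount (φ ρ) (φ τ) α′ β′
      intNo ρ τ t ρ-valid τ-valid t-valid α β α′ β′ α≢0 β≢0 α′≢0 β′≢0 αβ∈t α′β′∈φt = begin
        pathCount ρ τ α β             ≡⟨ pathCount≡kc -1∈K ρ τ t ρ-valid τ-valid t-valid α≢0 β≢0 αβ∈t ⟩
        kc ρ τ t                      ≡⟨ φ-invariant ρ τ t ρ-valid τ-valid t-valid ⟩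
        kc (φ ρ) (φ τ) (φ t)          ≡⟨ pathCount≡kc -1∈K (φ ρ) (φ τ) (φ t) (valid ρ ρ-valid) (valid τ τ-valid) (valid t t-valid)
                                           α′≢0 β′≢0 α′β′∈φt ⟨
        pathCount (φ ρ) (φ τ) α′ β′   ∎

    module _ {φ : SRep → SRep} (φ-alg : IsAlgAut φ) where
      open IsAlgAut φ-alg
      open IsPermS perm renaming (valid to φ-valid; resp to φ-resp; inj to φ-inj; surj to φ-surj)

      private
        invariant : KcInvariant φ
        invariant = IsAlgAut⇒KcInvariant φ-alg

        invariant-at : ∀ ρ τ t {ρ′ τ′ t′} → ValidS ρ → ValidS τ → ValidS t →
          φ ρ ≡ ρ′ → φ τ ≡ τ′ → φ t ≡ t′ → kc ρ τ t ≡ kc ρ′ τ′ t′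
        invariant-at ρ τ t ρ-valid τ-valid t-valid refl refl refl = invariant ρ τ t ρ-valid τ-valid t-valid

      φ-tag-r : ∀ {h} → h ≢ 0# → proj₁ (φ (rT , h)) ≡ rT
      φ-tag-r {h} h≢0 = proj₂ (proj₂ (kc≡q∣K∣⇒s,s,r (φ (sT , 1#)) (φ (sT , h)) (φ (rT , h))
        (trans (sym (invariant (sT , 1#) (sT , h) (rT , h) 1≢0 h≢0 h≢0)) (when-yes (h * 1# ≃? h) (≡⇒≃ h≢0 (*-identityʳ h)) _))))

      φ-tag-s : ∀ {h} → h ≢ 0# → proj₁ (φ (sT , h)) ≡ sT
      φ-tag-s {h} h≢0 = proj₁ (kc≡q∣K∣⇒s,s,r (φ (sT , h)) (φ (sT , h)) (φ (rT , 1#))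
        (trans (sym (invariant (sT , h) (sT , h) (rT , 1#) h≢0 h≢0 1≢0)) (when-yes (1# * h ≃? h) (≡⇒≃ h≢0 (*-identityˡ h)) _)))

      σ ζ : F → F
      σ h = proj₂ (φ (rT , h))
      ζ h = proj₂ (φ (sT , h))

      φ-r : ∀ {h} → h ≢ 0# → φ (rT , h) ≡ (rT , σ h)
      φ-r {h} h≢0 = cong (_, σ h) (φ-tag-r h≢0)

      φ-s : ∀ {h} → h ≢ 0# → φ (sT , h) ≡ (sT , ζ h)
      φ-s {h} h≢0 = cong (_, ζ h) (φ-tag-s h≢0)

      σ-aut : IsAutC σ
      σ-aut = record { valid = λ x x≢0 → φ-valid (rT , x) x≢0 ; resp = σ-resp ; hom = σ-hom ; inj = σ-inj ; surj = σ-surj }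
        where
        σ-resp : ∀ x y → x ≢ 0# → y ≢ 0# → x ~ y → σ x ~ σ y
        σ-resp x y x≢0 y≢0 x~y = proj₂ (φ-resp (rT , x) (rT , y) x≢0 y≢0 (refl , x~y))
        σ-inj : ∀ x y → x ≢ 0# → y ≢ 0# → σ x ~ σ y → x ~ y
        σ-inj x y x≢0 y≢0 σx~σy = proj₂ (φ-inj (rT , x) (rT , y) x≢0 y≢0 (trans (φ-tag-r x≢0) (sym (φ-tag-r y≢0)) , σx~σy))
        σ-hom : ∀ x y → x ≢ 0# → y ≢ 0# → σ (x * y) ~ (σ x * σ y)
        σ-hom x y x≢0 y≢0 = ratio∈K (when-pos (σ (x * y) ≃? σ x * σ y) (subst (0 <_) ∣K∣≡ 1≤∣K∣))
          where
          xy≢0 : x * y ≢ 0#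
          xy≢0 = x*y≢0 x≢0 y≢0
          ∣K∣≡ : ∣K∣ ≡ when (σ (x * y) ≃? σ x * σ y) ∣K∣
          ∣K∣≡ = trans (sym (when-yes (x * y ≃? x * y) (≃-refl xy≢0) ∣K∣))
            (invariant-at (rT , x) (rT , y) (rT , x * y) x≢0 y≢0 xy≢0 (φ-r x≢0) (φ-r y≢0) (φ-r xy≢0))
        σ-surj : ∀ y → y ≢ 0# → Σ F (λ x → x ≢ 0# × σ x ~ y)
        σ-surj y y≢0 with φ-surj (rT , y) y≢0
        ... | (rT , x) , x≢0 , _ , σx~y = x , x≢0 , σx~y
        ... | (sT , x) , x≢0 , sT≡rT , _ = contradiction (trans (sym (φ-tag-s x≢0)) sT≡rT) λ ()

      ζ~σ*ζ1 : ∀ {h} → h ≢ 0# → ζ h ~ (σ h * ζ 1#)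
      ζ~σ*ζ1 {h} h≢0 = ratio∈K (≃-sym (when-pos (σ h * ζ 1# ≃? ζ h) (subst (0 <_) ∣K∣≡ 1≤∣K∣)))
        where
        ∣K∣≡ : ∣K∣ ≡ when (σ h * ζ 1# ≃? ζ h) ∣K∣
        ∣K∣≡ = trans (sym (when-yes (h * 1# ≃? h) (≡⇒≃ h≢0 (*-identityʳ h)) ∣K∣))
          (invariant-at (rT , h) (sT , h) (sT , 1#) h≢0 h≢0 1≢0 (φ-r h≢0) (φ-s h≢0) (φ-s 1≢0))

      IsAlgAut⇒≈φ[,] : Σ (F → F) λ σ → IsAutC σ × Σ F λ g → g ≢ 0# × (∀ t → ValidS t → φ t ≈S φ[ σ , g ] t)
      IsAlgAut⇒≈φ[,] = σ , σ-aut , ζ 1# , φ-valid (sT , 1#) 1≢0 , φ≈φ[σ,ζ1]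
        where
        φ≈φ[σ,ζ1] : ∀ t → ValidS t → φ t ≈S φ[ σ , ζ 1# ] t
        φ≈φ[σ,ζ1] (rT , h) h≢0 = φ-tag-r h≢0 , ratio∈K (≃-refl (φ-valid (rT , h) h≢0))
        φ≈φ[σ,ζ1] (sT , h) h≢0 = φ-tag-s h≢0 , ζ~σ*ζ1 h≢0

-- Imported only here: the modules above open the field's own _*_.
open import Data.Nat using (_*_; _∸_; _^_)

lemma3p4 : (𝔽 : FiniteField) (r d : ℕ) → Prime r → FiniteField.order 𝔽 ≡ r ^ d →
  (n : ℕ) (H : Tatra.Subgroup 𝔽 n) →
  -- n ∣ q - 1, with m = (q - 1)/n, and q(q-1)/n = q·m even
  (m : ℕ) → FiniteField.order 𝔽 ∸ 1 ≡ n * m → 2 ∣ FiniteField.order 𝔽 * m →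
  let open FiniteField 𝔽
      open Tatra.WithK 𝔽 H
  in
  -- every algebraic automorphism is some φ_{σ,g}
  ((φ : SRep → SRep) → IsAlgAut φ →
     Σ (F → F) λ σ → IsAutC σ × Σ F λ g → g ≢ 0# ×
       (∀ t → ValidS t → φ t ≈S φ[ σ , g ] t))
  -- every φ_{σ,g} is an algebraic automorphism
  × ((σ : F → F) (g : F) → IsAutC σ → g ≢ 0# → IsAlgAut φ[ σ , g ])
  -- (σ,g) ↦ φ_{σ,g} is injective, so the group is {φ_{σ,g}} ≅ Hol(C)
  × ((σ τ : F → F) (g h : F) → IsAutC σ → IsAutC τ → g ≢ 0# → h ≢ 0# →
       (∀ t → ValidS t → φ[ σ , g ] t ≈S φ[ τ , h ] t) →
       (∀ x → x ≢ 0# → σ x ~ τ x) × g ~ h)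
lemma3p4 𝔽 _ _ _ _ n H m q-1≡nm 2∣qm =
    (λ φ φ-alg → IsAlgAut⇒≈φ[,] -1∈K φ-alg)
  , (λ σ g σ-aut g≢0 → KcInvariant⇒IsAlgAut -1∈K (φ[σ,g]-perm σ-aut g≢0) (φ[σ,g]-invariant σ-aut g≢0))
  , φ[,]-injective
  where
  open FiniteField 𝔽
  open Automorphisms 𝔽 H
  -1∈K : Tatra.Subgroup.K H (- 1#)
  -1∈K = CosetProperties.even⇒-1∈K 𝔽 H m q-1≡nm 2∣qm
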